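{- Let $L$ be a Boolean language given by a Boolean grammar in Binary Normal Form. Then $L\in\mathrm{DAL}[n^2]$, i.e., there is a Deterministic Automatic Register Machine deciding membership in $L$ of inputs of length $n$ in $O(n^2)$ steps.
   Context: A Boolean grammar $(N,\Sigma,P,S)$ extends context-free grammars by rules $A\to\alpha\,\&\,\beta$ (meaning $A\Rightarrow^* w$ if both $\alpha\Rightarrow^* w$ and $\beta\Rightarrow^* w$) and $A\to\neg\alpha$ (meaning $A\Rightarrow^* w$ if $\alpha\not\Rightarrow^* w$), in the sense of Okhotin. It is in Binary Normal Form if every rule except possibly $S\to\varepsilon$ has the form $A\to u$ or $A\to B_1C_1\,\&\cdots\&\,B_mC_m\,\&\,\neg D_1E_1\,\&\cdots\&\,\neg D_kE_k\,\&\,\neg\varepsilon$ with $m\ge1$, $k\ge0$, all capital letters nonterminals and $u\in\Sigma$. Convolution of strings pairs them symbol by symbol, padding shorter ones with a new symbol $\#$; a relation/function is automatic if the set of convolutions of its tuples (of its graph) is regular. A Deterministic Automatic Register Machine (DARM) has finitely many registers holding strings over a finite alphabet $\Gamma\supseteq\Sigma$ (initially empty) and a finite program: read input into a register, write a register, assign a constant string, copy a register, assign the value of an automatic function of registers, goto, conditional goto on an automatic predicate, halt/accept/reject; each executed instruction is one step. $\mathrm{DAL}[f(n)]$ is the class of languages accepted by a DARM in $O(f(n))$ steps on inputs of length $n$. -}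

module Defs where

open import Data.Nat using (ℕ; zero; suc; _+_; _*_; _^_; _≤_; _⊔_)
open import Data.Fin using (Fin; zero; suc; _↑ˡ_)
open import Data.Fin.Properties using (_≟_)
open import Data.Bool using (Bool; true; false; _∧_; _∨_; not; if_then_else_)
open import Data.List using (List; []; _∷_; length; foldl; map)
open import Data.Bool.ListAction using (any; all)
open import Data.List.NonEmpty using (List⁺; toList)
open import Data.Vec using (Vec; []; _∷_; lookup; replicate; _[_]≔_)
import Data.Vec as V
open import Data.Maybe using (Maybe; just; nothing)
open import Data.Product using (Σ; ∃; ∃-syntax; _×_; _,_; proj₁; proj₂)
open import Relation.Binary.PropositionalEquality using (_≡_)
open import Relation.Nullary using (¬_)
open import Relation.Nullary.Decidable using (⌊_⌋)
import Data.List.Membership.Propositional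
import Data.Maybe

-- A rule  A → B₁C₁ & … & BₘCₘ & ¬D₁E₁ & … & ¬DₖEₖ & ¬ε   (m ≥ 1, k ≥ 0)
record LongRule (n : ℕ) : Set where
  field
    lhs : Fin n
    pos : List⁺ (Fin n × Fin n)
    neg : List (Fin n × Fin n)

record BNFGrammar (s : ℕ) : Set where
  field
    n         : ℕ
    start     : Fin n
    termRules : List (Fin n × Fin s)
    longRules : List (LongRule n)
    epsRule   : Bool
    -- standard BNF requirement: if S → ε is present, S occurs in no right-hand side
    startNotOnRHS : epsRule ≡ true →
      (r : LongRule n) → Data.List.Membership.Propositional._∈_ r longRules →
      ((p : Fin n × Fin n) → Data.List.Membership.Propositional._∈_ p (toList (LongRule.pos r)) →
          ¬ (proj₁ p ≡ start) × ¬ (proj₂ p ≡ start)) ×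
      ((p : Fin n × Fin n) → Data.List.Membership.Propositional._∈_ p (LongRule.neg r) →
          ¬ (proj₁ p ≡ start) × ¬ (proj₂ p ≡ start))

splits : {A : Set} → List A → List (List A × List A)
splits []           = []
splits (a ∷ [])     = []
splits (a ∷ b ∷ xs) = ((a ∷ []) , (b ∷ xs)) ∷ map (λ p → (a ∷ proj₁ p) , proj₂ p) (splits (b ∷ xs))

module _ {s : ℕ} (G : BNFGrammar s) where
  open BNFGrammar G

  -- one unfolding of the semantics on nonempty strings, given membership
  -- for strictly shorter strings
  semStep : (List (Fin s) → Fin n → Bool) → List (Fin s) → Fin n → Bool
  semStep m [] A = false
  semStep m w@(_ ∷ _) A = termOK w ∨ any longOK longRules
    where
      termOK : List (Fin s) → Bool
      termOK (a ∷ []) = any (λ r → ⌊ proj₁ r ≟ A ⌋ ∧ ⌊ proj₂ r ≟ a ⌋) termRules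
      termOK _        = false
      inConcat : Fin n × Fin n → Bool
      inConcat (B , C) = any (λ uv → m (proj₁ uv) B ∧ m (proj₂ uv) C) (splits w)
      longOK : LongRule n → Bool
      longOK r = ⌊ LongRule.lhs r ≟ A ⌋
               ∧ all inConcat (toList (LongRule.pos r))
               ∧ all (λ p → not (inConcat p)) (LongRule.neg r)

  -- membership of nonempty strings, by induction on the length (fuel)
  memN : ℕ → List (Fin s) → Fin n → Bool
  memN zero    _ _ = false
  memN (suc k) w A = semStep (memN k) w A

  inL : List (Fin s) → Bool
  inL []          = epsRule
  inL w@(_ ∷ _)   = memN (length w) w start

maxLen : {A : Set} {k : ℕ} → Vec (List A) k → ℕ
maxLen []       = 0
maxLen (x ∷ xs) = length x ⊔ maxLen xs

headM : {A : Set} → List A → Maybe A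
headM []      = nothing
headM (a ∷ _) = just a

tailL : {A : Set} → List A → List A
tailL []       = []
tailL (_ ∷ as) = as

convN : {A : Set} {k : ℕ} → ℕ → Vec (List A) k → List (Vec (Maybe A) k)
convN zero    xs = []
convN (suc m) xs = V.map headM xs ∷ convN m (V.map tailL xs)

-- convolution; 'nothing' plays the role of the padding symbol #
conv : {A : Set} {k : ℕ} → Vec (List A) k → List (Vec (Maybe A) k)
conv xs = convN (maxLen xs) xs

record DFA (A : Set) : Set where
  field
    Q     : ℕ
    q₀    : Fin Q
    δ     : Fin Q → A → Fin Q
    final : Fin Q → Bool

accepts : {A : Set} → DFA A → List A → Bool
accepts M u = DFA.final M (foldl (DFA.δ M) (DFA.q₀ M) u)

record AutoFun (g k : ℕ) : Set where
  field
    fn  : Vec (List (Fin g)) k → List (Fin g)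
    dfa : DFA (Vec (Maybe (Fin g)) (suc k))
    recognisesGraph : (u : List (Vec (Maybe (Fin g)) (suc k))) →
      (accepts dfa u ≡ true → ∃[ xs ] u ≡ conv (fn xs ∷ xs)) ×
      (∃[ xs ] u ≡ conv (fn xs ∷ xs) → accepts dfa u ≡ true)

record AutoPred (g k : ℕ) : Set where
  field
    pred : Vec (List (Fin g)) k → Bool
    dfa  : DFA (Vec (Maybe (Fin g)) k)
    recognises : (u : List (Vec (Maybe (Fin g)) k)) →
      (accepts dfa u ≡ true → ∃[ xs ] (u ≡ conv xs × pred xs ≡ true)) ×
      (∃[ xs ] (u ≡ conv xs × pred xs ≡ true) → accepts dfa u ≡ true)

-- Deterministic Automatic Register Machines
-- g = size of register alphabet Γ, r = number of registers, p = program length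

data Instr (g r p : ℕ) : Set where
  read    : Fin r → Instr g r p
  write   : Fin r → Instr g r p                         -- output R (no effect on acceptance)
  const   : Fin r → List (Fin g) → Instr g r p
  copy    : Fin r → Fin r → Instr g r p
  apply   : {k : ℕ} → Fin r → Vec (Fin r) k → AutoFun g k → Instr g r p
  goto    : Fin p → Instr g r p
  ifGoto  : {k : ℕ} → Vec (Fin r) k → AutoPred g k → Fin p → Instr g r p
  halt    : Instr g r p
  accept  : Instr g r p
  reject  : Instr g r p

-- Γ = Fin (s + t) ⊇ Σ = Fin s (embedded via _↑ˡ_)
record DARM (s : ℕ) : Set where
  field
    t    : ℕ
    r    : ℕ
    p    : ℕ
    prog : Fin p → Instr (s + t) r p

nextPC : {p : ℕ} → Fin p → Maybe (Fin p)
nextPC {suc zero}    zero    = nothing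
nextPC {suc (suc p)} zero    = just (suc zero)
nextPC {suc (suc p)} (suc i) = Data.Maybe.map suc (nextPC i)

firstPC : (p : ℕ) → Maybe (Fin p)
firstPC zero    = nothing
firstPC (suc p) = just zero

module _ {s : ℕ} (M : DARM s) (w : List (Fin s)) where
  open DARM M

  Regs : Set
  Regs = Vec (List (Fin (s + t))) r

  input : List (Fin (s + t))
  input = map (λ a → a ↑ˡ t) w

  -- run for at most 'fuel' executed instructions; 'just b' = halted with verdict b
  -- (running off the end of the program = halting without accepting)
  run : ℕ → Maybe (Fin p) → Regs → Maybe Bool
  run fuel    nothing   ρ = just false
  run zero    (just pc) ρ = nothing
  run (suc f) (just pc) ρ with prog pc
  ... | read i        = run f (nextPC pc) (ρ [ i ]≔ input)
  ... | write i       = run f (nextPC pc) ρ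
  ... | const i c     = run f (nextPC pc) (ρ [ i ]≔ c)
  ... | copy i j      = run f (nextPC pc) (ρ [ i ]≔ lookup ρ j)
  ... | apply i js F  = run f (nextPC pc) (ρ [ i ]≔ AutoFun.fn F (V.map (lookup ρ) js))
  ... | goto ℓ        = run f (just ℓ) ρ
  ... | ifGoto js P ℓ = if AutoPred.pred P (V.map (lookup ρ) js)
                          then run f (just ℓ) ρ else run f (nextPC pc) ρ
  ... | halt          = just false
  ... | accept        = just true
  ... | reject        = just false

  runFrom : ℕ → Maybe Bool
  runFrom fuel = run fuel (firstPC p) (replicate r [])

DAL : {s : ℕ} → (ℕ → ℕ) → (List (Fin s) → Bool) → Set
DAL {s} f L = Σ (DARM s) λ M → Σ ℕ λ c → Σ ℕ λ n₀ →
  (w : List (Fin s)) → Σ ℕ λ steps →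
    (runFrom M w steps ≡ just (L w)) × (n₀ ≤ length w → steps ≤ c * f (length w))

module Submission where

-- A CYK-style recognition procedure, run on one register holding a tape of (n+1)² cells,
-- cell (e , m) standing for the factor of the input of length m ending at position e.
-- Stage l computes at once, for every e, the nonterminals deriving the factor of length l
-- ending at e: a single left-to-right pass of a finite-state transducer over block e meets
-- every split of that factor, provided the nonterminals of the left parts have first been
-- moved next to those of the right parts, which takes O(n) one-cell shifts of the tape. A
-- Boolean rule only combines finitely many membership bits, so the transducer can evaluate
-- it. Every pass and every shift is one application of an automatic function (a
-- letter-to-letter transducer acting on the convolution), so each of the n stages, as well
-- as each of the n rounds laying out the tape, costs O(n) steps: O(n²) in total.

open import Defs
open import Data.Nat using (ℕ; zero; suc; z<s; _≡ᵇ_; _+_; _*_; _^_; _⊔_; _⊓_; _∸_; pred; _≤_; _<_; z≤n; s≤s)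
open import Data.Nat.Properties hiding (_≟_)
open import Data.Nat.Tactic.RingSolver using (solve-∀)
open import Data.Fin using (Fin; zero; suc; #_; combine; remQuot; _↑ˡ_; _↑ʳ_; splitAt)
open import Data.Fin.Properties using (_≟_; remQuot-combine; splitAt-↑ˡ; splitAt-↑ʳ)
open import Data.Bool using (Bool; true; false; _∧_; _∨_; not; if_then_else_)
open import Data.Bool.Properties using (∧-zeroʳ; ∧-conicalˡ; ∧-conicalʳ; T-≡)
open import Data.Bool.ListAction using (any; all)
open import Data.List using (List; []; _∷_; foldl; map; length; _++_; take; drop; replicate; applyUpTo; fromMaybe)
open import Data.List.Properties using (length-applyUpTo; map-id; map-++; length-map; length-take; length-drop; take-take; drop-drop; take-all; take-[])
open import Data.List.NonEmpty using (toList)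
open import Data.List.Relation.Unary.All using (All; []; _∷_)
open import Data.Vec using (Vec; []; _∷_; lookup; tabulate; zipWith)
import Data.Vec as V
open import Data.Vec.Properties using (tabulate-cong; lookup∘tabulate; lookup-replicate)
open import Data.Maybe using (Maybe; just; nothing; is-just; is-nothing)
import Data.Maybe as Maybe
open import Data.Product using (Σ; _×_; _,_; proj₁; proj₂)
open import Data.Sum using (_⊎_; inj₁; inj₂; [_,_]′)
open import Data.Unit using (⊤; tt)
open import Data.Empty using (⊥; ⊥-elim)
open import Relation.Nullary using (yes; no; does)
open import Relation.Nullary.Decidable using (⌊_⌋; dec-true)
open import Relation.Binary.PropositionalEquality
open import Function.Bundles using (Equivalence)

true≢false : true ≢ false
true≢false ()

∧-true : ∀ {a b} → a ≡ true → b ≡ true → a ∧ b ≡ true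
∧-true refl refl = refl

∧₄-true⇒ : ∀ {a b c d} → a ∧ (b ∧ (c ∧ d)) ≡ true → (a ≡ true) × (b ≡ true) × (c ≡ true) × (d ≡ true)
∧₄-true⇒ {true} {true} {true} {true} _ = refl , refl , refl , refl

∧2-false : ∀ a b → a ∧ (false ∧ b) ≡ false
∧2-false false b = refl
∧2-false true b = refl

∧3-false : ∀ a b c → a ∧ (b ∧ (false ∧ c)) ≡ false
∧3-false false b c = refl
∧3-false true false c = refl
∧3-false true true c = refl

∨-true⇒ : ∀ {a b} → a ∨ b ≡ true → (a ≡ true) ⊎ (b ≡ true)
∨-true⇒ {true} _ = inj₁ refl
∨-true⇒ {false} e = inj₂ e

∨-introˡ : ∀ {a} b → a ≡ true → a ∨ b ≡ true
∨-introˡ b refl = refl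

∨-introʳ : ∀ a {b} → b ≡ true → a ∨ b ≡ true
∨-introʳ true _ = refl
∨-introʳ false e = e

Bool-ext : ∀ {a b} → (a ≡ true → b ≡ true) → (b ≡ true → a ≡ true) → a ≡ b
Bool-ext {false} {false} _ _ = refl
Bool-ext {false} {true} _ g = g refl
Bool-ext {true} {false} f _ = sym (f refl)
Bool-ext {true} {true} _ _ = refl

if-true : ∀ {A : Set} b (x y : A) → b ≡ true → (if b then x else y) ≡ x
if-true .true x y refl = refl

if-false : ∀ {A : Set} b (x y : A) → b ≡ false → (if b then x else y) ≡ y
if-false .false x y refl = refl

infix 4 _≤ᵇ′_ _<ᵇ′_

-- Unlike the library's _≤ᵇ_, which goes through _<ᵇ_, this comparison is structurally
-- recursive in both arguments, so that suc m ≤ᵇ′ suc n reduces to m ≤ᵇ′ n.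
_≤ᵇ′_ : ℕ → ℕ → Bool
zero ≤ᵇ′ _ = true
suc _ ≤ᵇ′ zero = false
suc a ≤ᵇ′ suc b = a ≤ᵇ′ b

_<ᵇ′_ : ℕ → ℕ → Bool
a <ᵇ′ b = suc a ≤ᵇ′ b

≡⇒≡ᵇ-true : ∀ {a b} → a ≡ b → (a ≡ᵇ b) ≡ true
≡⇒≡ᵇ-true {a} {b} e = Equivalence.to T-≡ (≡⇒≡ᵇ a b e)

≡ᵇ-refl : ∀ a → (a ≡ᵇ a) ≡ true
≡ᵇ-refl a = ≡⇒≡ᵇ-true {a} refl

≡ᵇ-true⇒≡ : ∀ a b → (a ≡ᵇ b) ≡ true → a ≡ b
≡ᵇ-true⇒≡ a b e = ≡ᵇ⇒≡ a b (Equivalence.from T-≡ e)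

<⇒≡ᵇ-false : ∀ a b → a < b → (a ≡ᵇ b) ≡ false
<⇒≡ᵇ-false zero (suc b) _ = refl
<⇒≡ᵇ-false (suc a) (suc b) (s≤s lt) = <⇒≡ᵇ-false a b lt

>⇒≡ᵇ-false : ∀ a b → b < a → (a ≡ᵇ b) ≡ false
>⇒≡ᵇ-false (suc a) zero _ = refl
>⇒≡ᵇ-false (suc a) (suc b) (s≤s lt) = >⇒≡ᵇ-false a b lt

≤⇒≤ᵇ′ : ∀ a b → a ≤ b → (a ≤ᵇ′ b) ≡ true
≤⇒≤ᵇ′ zero b _ = refl
≤⇒≤ᵇ′ (suc a) (suc b) (s≤s le) = ≤⇒≤ᵇ′ a b le

>⇒≤ᵇ′-false : ∀ a b → b < a → (a ≤ᵇ′ b) ≡ false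
>⇒≤ᵇ′-false (suc a) zero _ = refl
>⇒≤ᵇ′-false (suc a) (suc b) (s≤s lt) = >⇒≤ᵇ′-false a b lt

≤ᵇ′-refl : ∀ k → (k ≤ᵇ′ k) ≡ true
≤ᵇ′-refl k = ≤⇒≤ᵇ′ k k ≤-refl

≤ᵇ′⇒≤ : ∀ a b → (a ≤ᵇ′ b) ≡ true → a ≤ b
≤ᵇ′⇒≤ zero b _ = z≤n
≤ᵇ′⇒≤ (suc a) zero ()
≤ᵇ′⇒≤ (suc a) (suc b) e = s≤s (≤ᵇ′⇒≤ a b e)

≤ᵇ′-suc-≢ : ∀ m l → (m ≡ᵇ l) ≡ false → (suc m ≤ᵇ′ l) ≡ (m ≤ᵇ′ l)
≤ᵇ′-suc-≢ zero zero ()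
≤ᵇ′-suc-≢ zero (suc l) _ = refl
≤ᵇ′-suc-≢ (suc m) zero _ = refl
≤ᵇ′-suc-≢ (suc m) (suc l) e = ≤ᵇ′-suc-≢ m l e

≤ᵇ′-suc-self : ∀ l → (suc l ≤ᵇ′ l) ≡ false
≤ᵇ′-suc-self zero = refl
≤ᵇ′-suc-self (suc l) = ≤ᵇ′-suc-self l

∸-telescope : ∀ e l m → m ≤ l → l ≤ e → (e ∸ l) + (l ∸ m) ≡ e ∸ m
∸-telescope e l zero _ le = m∸n+n≡m le
∸-telescope (suc e) (suc l) (suc m) (s≤s ml) (s≤s le) = ∸-telescope e l m ml le

anyBelow : ℕ → (ℕ → Bool) → Bool
anyBelow zero f = false
anyBelow (suc m) f = anyBelow m f ∨ f m

anyBelow-witness : ∀ m f → anyBelow m f ≡ true → Σ ℕ λ j → (j < m) × (f j ≡ true)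
anyBelow-witness (suc m) f e with ∨-true⇒ {anyBelow m f} e
... | inj₁ e' = let (j , lt , fj) = anyBelow-witness m f e' in j , ≤-trans lt (n≤1+n m) , fj
... | inj₂ e' = m , ≤-refl , e'

anyBelow-intro : ∀ m f j → j < m → f j ≡ true → anyBelow m f ≡ true
anyBelow-intro (suc m) f j (s≤s le) fj with m≤n⇒m<n∨m≡n le
... | inj₁ lt = ∨-introˡ (f m) (anyBelow-intro m f j lt fj)
... | inj₂ refl = ∨-introʳ (anyBelow j f) fj

anyBelow-false : ∀ k f → (∀ m → f m ≡ false) → anyBelow k f ≡ false
anyBelow-false zero f h = refl
anyBelow-false (suc k) f h rewrite anyBelow-false k f h | h k = refl

applyUpTo-cong : {A : Set} (L : ℕ) (f h : ℕ → A) → (∀ p → p < L → f p ≡ h p) → applyUpTo f L ≡ applyUpTo h L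
applyUpTo-cong zero f h e = refl
applyUpTo-cong (suc L) f h e = cong₂ _∷_ (e 0 (s≤s z≤n)) (applyUpTo-cong L _ _ (λ p lt → e (suc p) (s≤s lt)))

applyUpTo-+ : {A : Set} (K L : ℕ) (f : ℕ → A) → applyUpTo f (K + L) ≡ applyUpTo f K ++ applyUpTo (λ p → f (K + p)) L
applyUpTo-+ zero L f = refl
applyUpTo-+ (suc K) L f = cong (f 0 ∷_) (applyUpTo-+ K L _)

module _ {C : Set} where
  foldl-∧-true : ∀ (q : C → Bool) L f → (∀ p → p < L → q (f p) ≡ true) → foldl (λ b c → b ∧ q c) true (applyUpTo f L) ≡ true
  foldl-∧-true q zero f h = refl
  foldl-∧-true q (suc L) f h rewrite h 0 (s≤s z≤n) = foldl-∧-true q L (λ p → f (suc p)) (λ p lt → h (suc p) (s≤s lt))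

  foldl-∧-false : ∀ (q : C → Bool) L f → foldl (λ b c → b ∧ q c) false (applyUpTo f L) ≡ false
  foldl-∧-false q zero f = refl
  foldl-∧-false q (suc L) f = foldl-∧-false q L (λ p → f (suc p))

  foldl-∧-witness : ∀ (q : C → Bool) L f j → j < L → q (f j) ≡ false → foldl (λ b c → b ∧ q c) true (applyUpTo f L) ≡ false
  foldl-∧-witness q (suc L) f zero lt e rewrite e = foldl-∧-false q L (λ p → f (suc p))
  foldl-∧-witness q (suc L) f (suc j) (s≤s lt) e with q (f 0)
  ... | true = foldl-∧-witness q L (λ p → f (suc p)) j lt e
  ... | false = foldl-∧-false q L (λ p → f (suc p))

  foldl-last : ∀ (q : C → Bool) L f b → foldl (λ _ c → q c) b (applyUpTo f (suc L)) ≡ q (f L)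
  foldl-last q zero f b = refl
  foldl-last q (suc L) f b = foldl-last q L (λ p → f (suc p)) (q (f 0))

any-false : ∀ {A : Set} (f : A → Bool) xs → (∀ x → f x ≡ false) → any f xs ≡ false
any-false f [] h = refl
any-false f (x ∷ xs) h rewrite h x = any-false f xs h

module _ {A : Set} where
  any-cong : ∀ (f h : A → Bool) xs → (∀ x → f x ≡ h x) → any f xs ≡ any h xs
  any-cong f h [] e = refl
  any-cong f h (x ∷ xs) e = cong₂ _∨_ (e x) (any-cong f h xs e)

  all-cong : ∀ (f h : A → Bool) xs → (∀ x → f x ≡ h x) → all f xs ≡ all h xs
  all-cong f h [] e = refl
  all-cong f h (x ∷ xs) e = cong₂ _∧_ (e x) (all-cong f h xs e)

module _ {A : Set} where
  any-cong-All : ∀ (P : A → Set) (f h : A → Bool) xs → All P xs → (∀ x → P x → f x ≡ h x) → any f xs ≡ any h xs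
  any-cong-All P f h [] [] e = refl
  any-cong-All P f h (x ∷ xs) (px ∷ pxs) e = cong₂ _∨_ (e x px) (any-cong-All P f h xs pxs e)

  ProperSplit : List A → List A × List A → Set
  ProperSplit v uv = (suc (length (proj₁ uv)) ≤ length v) × (suc (length (proj₂ uv)) ≤ length v)

  splits-proper : ∀ (v : List A) → All (ProperSplit v) (splits v)
  splits-proper [] = []
  splits-proper (a ∷ []) = []
  splits-proper (a ∷ b ∷ xs) = (s≤s (s≤s z≤n) , ≤-refl) ∷ mp (splits (b ∷ xs)) (splits-proper (b ∷ xs))
    where
      mp : ∀ ys → All (ProperSplit (b ∷ xs)) ys → All (ProperSplit (a ∷ b ∷ xs)) (map (λ p → (a ∷ proj₁ p) , proj₂ p) ys)
      mp [] [] = []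
      mp (y ∷ ys) ((p , q) ∷ r) = (s≤s p , m≤n⇒m≤1+n q) ∷ mp ys r

module _ {A : Set} where
  any-map : ∀ (f : List A × List A → Bool) (h : List A × List A → List A × List A) ys →
      any f (map h ys) ≡ any (λ y → f (h y)) ys
  any-map f h [] = refl
  any-map f h (y ∷ ys) = cong (f (h y) ∨_) (any-map f h ys)

  splits-witness : ∀ (f : List A × List A → Bool) u → any f (splits u) ≡ true →
             Σ ℕ λ j → (1 ≤ j) × (j < length u) × (f (take j u , drop j u) ≡ true)
  splits-witness f [] ()
  splits-witness f (a ∷ []) ()
  splits-witness f (a ∷ b ∷ xs) e = aux (∨-true⇒ {f ((a ∷ []) , (b ∷ xs))} e)
      (λ e' → splits-witness (λ uv → f ((a ∷ proj₁ uv) , proj₂ uv)) (b ∷ xs) (trans (sym (any-map f _ (splits (b ∷ xs)))) e'))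
    where
      aux : (f ((a ∷ []) , (b ∷ xs)) ≡ true) ⊎ (any f (map (λ p → (a ∷ proj₁ p) , proj₂ p) (splits (b ∷ xs))) ≡ true) →
            (any f (map (λ p → (a ∷ proj₁ p) , proj₂ p) (splits (b ∷ xs))) ≡ true →
              Σ ℕ λ j → (1 ≤ j) × (j < length (b ∷ xs)) × (f ((a ∷ take j (b ∷ xs)) , drop j (b ∷ xs)) ≡ true)) →
            Σ ℕ λ j → (1 ≤ j) × (j < length (a ∷ b ∷ xs)) × (f (take j (a ∷ b ∷ xs) , drop j (a ∷ b ∷ xs)) ≡ true)
      aux (inj₁ e') _ = 1 , s≤s z≤n , s≤s (s≤s z≤n) , e'
      aux (inj₂ e') rec with rec e'
      ... | (j , p , q , r) = suc j , s≤s z≤n , s≤s q , r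

  splits-intro : ∀ (f : List A × List A → Bool) u j → 1 ≤ j → j < length u → f (take j u , drop j u) ≡ true →
      any f (splits u) ≡ true
  splits-intro f (a ∷ []) (suc zero) _ (s≤s ()) _
  splits-intro f (a ∷ b ∷ xs) (suc zero) _ _ e = ∨-introˡ _ e
  splits-intro f (a ∷ b ∷ xs) (suc (suc j)) _ (s≤s lt) e =
    ∨-introʳ (f ((a ∷ []) , (b ∷ xs)))
      (trans (any-map f _ (splits (b ∷ xs))) (splits-intro (λ uv → f ((a ∷ proj₁ uv) , proj₂ uv)) (b ∷ xs) (suc j) (s≤s z≤n) lt e))

drop-take : {A : Set} → ∀ j l (xs : List A) → drop j (take l xs) ≡ take (l ∸ j) (drop j xs)
drop-take zero l xs = refl
drop-take (suc j) zero xs = refl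
drop-take (suc j) (suc l) [] = sym (take-[] (l ∸ j))
drop-take (suc j) (suc l) (x ∷ xs) = drop-take j l xs

headM-nonempty : ∀ {A : Set} (v : List A) → 0 < length v → is-nothing (headM v) ≡ false
headM-nonempty (a ∷ v) _ = refl

length-take≡ : ∀ {A : Set} j (u : List A) → j ≤ length u → length (take j u) ≡ j
length-take≡ j u le = trans (length-take j u) (m≤n⇒m⊓n≡m le)

replicate-snoc : ∀ {A : Set} r (b : A) x → replicate r b ++ (b ∷ x) ≡ replicate (suc r) b ++ x
replicate-snoc zero b x = refl
replicate-snoc (suc r) b x = cong (b ∷_) (replicate-snoc r b x)

tabulate-false : ∀ {N} (f : Fin N → Bool) → (∀ X → f X ≡ false) → tabulate f ≡ V.replicate N false
tabulate-false {zero} f h = refl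
tabulate-false {suc N} f h = cong₂ _∷_ (h zero) (tabulate-false (λ X → f (suc X)) (λ X → h (suc X)))

record Finite (A : Set) : Set where
  field
    size    : ℕ
    enc     : A → Fin size
    dec     : Fin size → A
    dec-enc : ∀ a → dec (enc a) ≡ a

open Finite

finite-retract : {A B : Set} → Finite A → (f : B → A) (h : A → B) → (∀ b → h (f b) ≡ b) → Finite B
finite-retract FA f h hf = record
  { size = size FA ; enc = λ b → enc FA (f b) ; dec = λ i → h (dec FA i)
  ; dec-enc = λ b → trans (cong h (dec-enc FA (f b))) (hf b) }

finite-Fin : (n : ℕ) → Finite (Fin n)
finite-Fin n = record { size = n ; enc = λ x → x ; dec = λ x → x ; dec-enc = λ _ → refl }

finite-⊤ : Finite ⊤
finite-⊤ = record { size = 1 ; enc = λ _ → zero ; dec = λ _ → tt ; dec-enc = λ _ → refl }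

finite-Maybe : {A : Set} → Finite A → Finite (Maybe A)
finite-Maybe {A} FA = record { size = suc (size FA) ; enc = encM ; dec = decM ; dec-enc = decM-encM }
  where
    encM : Maybe A → Fin (suc (size FA))
    encM nothing  = zero
    encM (just a) = suc (enc FA a)
    decM : Fin (suc (size FA)) → Maybe A
    decM zero    = nothing
    decM (suc i) = just (dec FA i)
    decM-encM : ∀ a → decM (encM a) ≡ a
    decM-encM nothing  = refl
    decM-encM (just a) = cong just (dec-enc FA a)

finite-Bool : Finite Bool
finite-Bool = finite-retract (finite-Maybe finite-⊤) (λ b → if b then just tt else nothing) is-just
  λ { true → refl ; false → refl }

finite-× : {A B : Set} → Finite A → Finite B → Finite (A × B)
finite-× {A} {B} FA FB = record
  { size = size FA * size FB
  ; enc = λ (a , b) → combine (enc FA a) (enc FB b)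
  ; dec = λ i → decPair (remQuot (size FB) i)
  ; dec-enc = λ (a , b) → trans (cong decPair (remQuot-combine (enc FA a) (enc FB b)))
                                (cong₂ _,_ (dec-enc FA a) (dec-enc FB b)) }
  where
    decPair : Fin (size FA) × Fin (size FB) → A × B
    decPair (i , j) = dec FA i , dec FB j

finite-Vec : {A : Set} → Finite A → (n : ℕ) → Finite (Vec A n)
finite-Vec FA zero    = record { size = 1 ; enc = λ _ → zero ; dec = λ _ → [] ; dec-enc = λ { [] → refl } }
finite-Vec FA (suc n) = finite-retract (finite-× FA (finite-Vec FA n)) (λ { (a ∷ v) → a , v })
  (λ (a , v) → a ∷ v) λ { (a ∷ v) → refl }

≟-true⇒≡ : {n : ℕ} (i j : Fin n) → does (i ≟ j) ≡ true → i ≡ j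
≟-true⇒≡ i j e with i ≟ j
... | yes i≡j = i≡j

-- Automatic functions and predicates

module _ {A S : Set} (F : Finite S) (s0 : S) (δ : S → A → S) (fin : S → Bool) where
  dfaOf : DFA A
  dfaOf = record { Q = size F ; q₀ = enc F s0 ; δ = λ q a → enc F (δ (dec F q) a) ; final = λ q → fin (dec F q) }

  dec-foldl-dfaOf : ∀ (u : List A) q → dec F (foldl (DFA.δ dfaOf) q u) ≡ foldl δ (dec F q) u
  dec-foldl-dfaOf [] q = refl
  dec-foldl-dfaOf (a ∷ u) q rewrite dec-foldl-dfaOf u (enc F (δ (dec F q) a)) | dec-enc F (δ (dec F q) a) = refl

  accepts-dfaOf : ∀ u → accepts dfaOf u ≡ fin (foldl δ s0 u)
  accepts-dfaOf u rewrite dec-foldl-dfaOf u (enc F s0) | dec-enc F s0 = refl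

module _ {A : Set} where
  pred-⊔ : ∀ a b → pred a ⊔ pred b ≡ pred (a ⊔ b)
  pred-⊔ zero zero = refl
  pred-⊔ zero (suc b) = refl
  pred-⊔ (suc a) zero = ⊔-identityʳ a
  pred-⊔ (suc a) (suc b) = refl

  length-tailL : (x : List A) → length (tailL x) ≡ pred (length x)
  length-tailL [] = refl
  length-tailL (_ ∷ _) = refl

  maxLen-tail : ∀ {k} (xs : Vec (List A) k) → maxLen (V.map tailL xs) ≡ pred (maxLen xs)
  maxLen-tail [] = refl
  maxLen-tail (x ∷ xs) rewrite maxLen-tail xs | length-tailL x = pred-⊔ (length x) (maxLen xs)

  conv-suc : ∀ {k} (xs : Vec (List A) k) m → maxLen xs ≡ suc m →
             conv xs ≡ V.map headM xs ∷ conv (V.map tailL xs)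
  conv-suc xs m e rewrite e | maxLen-tail xs | e = refl

  maxLen-replicate-[] : ∀ k → maxLen (V.replicate {A = List A} k []) ≡ 0
  maxLen-replicate-[] zero = refl
  maxLen-replicate-[] (suc k) = maxLen-replicate-[] k

  conv-replicate-[] : ∀ k → conv (V.replicate {A = List A} k []) ≡ []
  conv-replicate-[] k rewrite maxLen-replicate-[] k = refl

  maxLen≡0⇒replicate : ∀ {k} (xs : Vec (List A) k) → maxLen xs ≡ 0 → xs ≡ V.replicate k []
  maxLen≡0⇒replicate [] _ = refl
  maxLen≡0⇒replicate ([] ∷ xs) e = cong ([] ∷_) (maxLen≡0⇒replicate xs e)
  maxLen≡0⇒replicate ((y ∷ ys) ∷ xs) e = ⊥-elim (z {length ys} {maxLen xs} e)
    where z : ∀ {a b} → suc a ⊔ b ≡ 0 → ⊥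
          z {b = zero} ()
          z {b = suc _} ()

  map-headM-replicate : ∀ k → V.map headM (V.replicate {A = List A} k []) ≡ V.replicate k nothing
  map-headM-replicate zero = refl
  map-headM-replicate (suc k) = cong (nothing ∷_) (map-headM-replicate k)

  allNothing : ∀ {k} → Vec (Maybe A) k → Bool
  allNothing [] = true
  allNothing (nothing ∷ v) = allNothing v
  allNothing (just _ ∷ v) = false

  allNothing⇒replicate : ∀ {k} (v : Vec (Maybe A) k) → allNothing v ≡ true → v ≡ V.replicate k nothing
  allNothing⇒replicate [] _ = refl
  allNothing⇒replicate (nothing ∷ v) e = cong (nothing ∷_) (allNothing⇒replicate v e)
  allNothing⇒replicate (just _ ∷ v) ()

  allNothing-replicate : ∀ k → allNothing (V.replicate {A = Maybe A} k nothing) ≡ true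
  allNothing-replicate zero = refl
  allNothing-replicate (suc k) = allNothing-replicate k

  maxLen-suc⇒heads-not-allNothing : ∀ {k} (xs : Vec (List A) k) m → maxLen xs ≡ suc m → allNothing (V.map headM xs) ≡ false
  maxLen-suc⇒heads-not-allNothing ([] ∷ xs) m e = maxLen-suc⇒heads-not-allNothing xs m e
  maxLen-suc⇒heads-not-allNothing ((_ ∷ _) ∷ xs) m e = refl

  -- Ended E xs: the tracks flagged in E are exhausted. The automaton for the graph of a
  -- transducer carries these flags to check that a padding symbol is followed only by padding.
  Ended : ∀ {k} → Vec Bool k → Vec (List A) k → Set
  Ended [] [] = ⊤
  Ended (false ∷ E) (_ ∷ xs) = Ended E xs
  Ended (true ∷ E) (x ∷ xs) = (x ≡ []) × Ended E xs

  Ended-replicate : ∀ {k} (E : Vec Bool k) → Ended E (V.replicate k [])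
  Ended-replicate [] = tt
  Ended-replicate (false ∷ E) = Ended-replicate E
  Ended-replicate (true ∷ E) = refl , Ended-replicate E

  respectsEnded : ∀ {k} → Vec Bool k → Vec (Maybe A) k → Bool
  respectsEnded [] [] = true
  respectsEnded (false ∷ E) (_ ∷ v) = respectsEnded E v
  respectsEnded (true ∷ E) (nothing ∷ v) = respectsEnded E v
  respectsEnded (true ∷ E) (just _ ∷ v) = false

  markEnded : ∀ {k} → Vec Bool k → Vec (Maybe A) k → Vec Bool k
  markEnded [] [] = []
  markEnded (e ∷ E) (m ∷ v) = (e ∨ is-nothing m) ∷ markEnded E v

  respectsEnded-heads : ∀ {k} (E : Vec Bool k) xs → Ended E xs → respectsEnded E (V.map headM xs) ≡ true
  respectsEnded-heads [] [] _ = refl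
  respectsEnded-heads (false ∷ E) (_ ∷ xs) ok = respectsEnded-heads E xs ok
  respectsEnded-heads (true ∷ E) (.[] ∷ xs) (refl , ok) = respectsEnded-heads E xs ok

  Ended-tails : ∀ {k} (E : Vec Bool k) xs → Ended E xs → Ended (markEnded E (V.map headM xs)) (V.map tailL xs)
  Ended-tails [] [] _ = tt
  Ended-tails (false ∷ E) ([] ∷ xs) ok = refl , Ended-tails E xs ok
  Ended-tails (false ∷ E) ((_ ∷ _) ∷ xs) ok = Ended-tails E xs ok
  Ended-tails (true ∷ E) (.[] ∷ xs) (refl , ok) = refl , Ended-tails E xs ok

  consM : Maybe A → List A → List A
  consM nothing l = l
  consM (just a) l = a ∷ l

  heads-zipWith-consM : ∀ {k} (E : Vec Bool k) v xs → Ended (markEnded E v) xs →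
               V.map headM (zipWith consM v xs) ≡ v
  heads-zipWith-consM [] [] [] _ = refl
  heads-zipWith-consM (false ∷ E) (nothing ∷ v) (.[] ∷ xs) (refl , ok) = cong (nothing ∷_) (heads-zipWith-consM E v xs ok)
  heads-zipWith-consM (false ∷ E) (just _ ∷ v) (_ ∷ xs) ok = cong (_ ∷_) (heads-zipWith-consM E v xs ok)
  heads-zipWith-consM (true ∷ E) (nothing ∷ v) (.[] ∷ xs) (refl , ok) = cong (nothing ∷_) (heads-zipWith-consM E v xs ok)
  heads-zipWith-consM (true ∷ E) (just _ ∷ v) (.[] ∷ xs) (refl , ok) = cong (_ ∷_) (heads-zipWith-consM E v xs ok)

  tails-zipWith-consM : ∀ {k} (E : Vec Bool k) v xs → Ended (markEnded E v) xs →
               V.map tailL (zipWith consM v xs) ≡ xs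
  tails-zipWith-consM [] [] [] _ = refl
  tails-zipWith-consM (false ∷ E) (nothing ∷ v) (.[] ∷ xs) (refl , ok) = cong ([] ∷_) (tails-zipWith-consM E v xs ok)
  tails-zipWith-consM (false ∷ E) (just _ ∷ v) (_ ∷ xs) ok = cong (_ ∷_) (tails-zipWith-consM E v xs ok)
  tails-zipWith-consM (true ∷ E) (nothing ∷ v) (.[] ∷ xs) (refl , ok) = cong ([] ∷_) (tails-zipWith-consM E v xs ok)
  tails-zipWith-consM (true ∷ E) (just _ ∷ v) (.[] ∷ xs) (refl , ok) = cong (_ ∷_) (tails-zipWith-consM E v xs ok)

  Ended-zipWith-consM : ∀ {k} (E : Vec Bool k) v xs → respectsEnded E v ≡ true → Ended (markEnded E v) xs →
                Ended E (zipWith consM v xs)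
  Ended-zipWith-consM [] [] [] _ _ = tt
  Ended-zipWith-consM (false ∷ E) (nothing ∷ v) (.[] ∷ xs) c (refl , ok) = Ended-zipWith-consM E v xs c ok
  Ended-zipWith-consM (false ∷ E) (just _ ∷ v) (_ ∷ xs) c ok = Ended-zipWith-consM E v xs c ok
  Ended-zipWith-consM (true ∷ E) (nothing ∷ v) (.[] ∷ xs) c (refl , ok) = refl , Ended-zipWith-consM E v xs c ok
  Ended-zipWith-consM (true ∷ E) (just _ ∷ v) (_ ∷ xs) () ok

  allNothing⇒maxLen≡0 : ∀ {k} (E : Vec Bool k) v xs → allNothing v ≡ true → Ended (markEnded E v) xs → maxLen xs ≡ 0
  allNothing⇒maxLen≡0 [] [] [] _ _ = refl
  allNothing⇒maxLen≡0 (false ∷ E) (nothing ∷ v) (.[] ∷ xs) a (refl , ok) = allNothing⇒maxLen≡0 E v xs a ok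
  allNothing⇒maxLen≡0 (true ∷ E) (nothing ∷ v) (.[] ∷ xs) a (refl , ok) = allNothing⇒maxLen≡0 E v xs a ok

  allNothing⇒maxLen-zipWith-consM≡0 : ∀ {k} (E : Vec Bool k) v xs → allNothing v ≡ true → Ended (markEnded E v) xs →
                      maxLen (zipWith consM v xs) ≡ 0
  allNothing⇒maxLen-zipWith-consM≡0 [] [] [] _ _ = refl
  allNothing⇒maxLen-zipWith-consM≡0 (false ∷ E) (nothing ∷ v) (.[] ∷ xs) a (refl , ok) =
      allNothing⇒maxLen-zipWith-consM≡0 E v xs a ok
  allNothing⇒maxLen-zipWith-consM≡0 (true ∷ E) (nothing ∷ v) (.[] ∷ xs) a (refl , ok) =
      allNothing⇒maxLen-zipWith-consM≡0 E v xs a ok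

  maxLen-zipWith-consM : ∀ {k} (E : Vec Bool k) v xs → allNothing v ≡ false → Ended (markEnded E v) xs →
                 maxLen (zipWith consM v xs) ≡ suc (maxLen xs)
  maxLen-zipWith-consM (false ∷ E) (nothing ∷ v) (.[] ∷ xs) a (refl , ok) = maxLen-zipWith-consM E v xs a ok
  maxLen-zipWith-consM (true ∷ E) (nothing ∷ v) (.[] ∷ xs) a (refl , ok) = maxLen-zipWith-consM E v xs a ok
  maxLen-zipWith-consM (e ∷ E) (just x ∷ v) (y ∷ xs) a ok = lem (allNothing v) refl
    where
      ok' : Ended (markEnded E v) xs
      ok' = okk e ok
        where okk : ∀ e → Ended ((e ∨ false) ∷ markEnded E v) (y ∷ xs) → Ended (markEnded E v) xs
              okk false o = o
              okk true (_ , o) = o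
      lem : ∀ b → allNothing v ≡ b → suc (length y) ⊔ maxLen (zipWith consM v xs) ≡ suc (length y ⊔ maxLen xs)
      lem false e rewrite maxLen-zipWith-consM E v xs e ok' = refl
      lem true e rewrite allNothing⇒maxLen≡0 E v xs e ok' | allNothing⇒maxLen-zipWith-consM≡0 E v xs e ok'
        = cong suc (sym (⊔-identityʳ (length y)))

  conv-zipWith-consM : ∀ {k} (E : Vec Bool k) v xs → allNothing v ≡ false → Ended (markEnded E v) xs →
               conv (zipWith consM v xs) ≡ v ∷ conv xs
  conv-zipWith-consM E v xs a ok
    rewrite conv-suc (zipWith consM v xs) (maxLen xs) (maxLen-zipWith-consM E v xs a ok)
          | heads-zipWith-consM E v xs ok | tails-zipWith-consM E v xs ok = refl

conv-cons : ∀ {A : Set} {k} (a : A) R (xs : Vec (List A) k) m → maxLen xs ≡ suc m →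
            conv ((a ∷ R) ∷ xs) ≡ (just a ∷ V.map headM xs) ∷ conv (R ∷ V.map tailL xs)
conv-cons a R xs m e = conv-suc ((a ∷ R) ∷ xs) (length R ⊔ m) (cong (λ t → suc (length R) ⊔ t) e)

record Mealy (g k : ℕ) : Set₁ where
  field
    S : Set
    finS : Finite S
    s0 : S
    step : S → Vec (Maybe (Fin g)) k → S × Fin g
    flush : S → Maybe (Fin g)

-- A transducer applied to the convolution of its arguments computes an automatic function:
-- the graph is recognised by running the transducer on the argument tracks while checking
-- its output against the first track.
module MealyFun {g k : ℕ} (M : Mealy g k) where
  open Mealy M

  runMealy : S → List (Vec (Maybe (Fin g)) k) → List (Fin g)
  runMealy s [] = fromMaybe (flush s)
  runMealy s (c ∷ u) = proj₂ (step s c) ∷ runMealy (proj₁ (step s c)) u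

  fun : Vec (List (Fin g)) k → List (Fin g)
  fun xs = runMealy s0 (conv xs)

  GraphState : Set
  GraphState = Maybe (Maybe (S × Vec Bool k))

  finite-GraphState : Finite GraphState
  finite-GraphState = finite-Maybe (finite-Maybe (finite-× finS (finite-Vec finite-Bool k)))

  flushCheck : Maybe (Fin g) → Maybe (Fin g) → GraphState
  flushCheck (just z) (just y) = if does (z ≟ y) then just nothing else nothing
  flushCheck _ _ = nothing

  outCheck : Maybe (Fin g) → S × Fin g → Vec Bool k → Vec (Maybe (Fin g)) k → GraphState
  outCheck (just y) (s' , o) E v = if does (o ≟ y) then just (just (s' , markEnded E v)) else nothing
  outCheck nothing _ _ _ = nothing

  graphStep : GraphState → Vec (Maybe (Fin g)) (suc k) → GraphState
  graphStep (just (just (s , E))) (y ∷ v) =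
    if allNothing v then flushCheck (flush s) y
    else (if respectsEnded E v then outCheck y (step s v) E v else nothing)
  graphStep _ _ = nothing

  graphFinal : GraphState → Bool
  graphFinal nothing = false
  graphFinal (just nothing) = true
  graphFinal (just (just (s , E))) = is-nothing (flush s)

  graphStep-dead : ∀ u → foldl graphStep nothing u ≡ nothing
  graphStep-dead [] = refl
  graphStep-dead (_ ∷ u) = graphStep-dead u

  InGraph : List (Vec (Maybe (Fin g)) (suc k)) → S → Vec Bool k → Set
  InGraph u s E = Σ (Vec (List (Fin g)) k) λ xs → Ended E xs × (u ≡ conv (runMealy s (conv xs) ∷ xs))

  is-nothing⇒nothing : ∀ (m : Maybe (Fin g)) → is-nothing m ≡ true → m ≡ nothing
  is-nothing⇒nothing nothing _ = refl
  is-nothing⇒nothing (just _) ()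

  graphFinal-dead : ∀ u → graphFinal (foldl graphStep nothing u) ≡ true → ⊥
  graphFinal-dead u e rewrite graphStep-dead u = true≢false (sym e)

  graph-sound-flush : ∀ y v u s E → allNothing v ≡ true →
                graphFinal (foldl graphStep (flushCheck (flush s) y) u) ≡ true → InGraph ((y ∷ v) ∷ u) s E
  graph-sound-flush y v u s E an acc with flush s in fe
  graph-sound-flush nothing v u s E an acc | just z = ⊥-elim (graphFinal-dead u acc)
  graph-sound-flush (just y) v u s E an acc | just z with does (z ≟ y) in zy
  graph-sound-flush (just y) v [] s E an acc | just z | true
    rewrite ≟-true⇒≡ z y zy | allNothing⇒replicate v an =
      V.replicate k [] , Ended-replicate E , goal
    where
      goal : (just y ∷ V.replicate k nothing) ∷ [] ≡ conv (runMealy s (conv (V.replicate k [])) ∷ V.replicate k [])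
      goal rewrite conv-replicate-[] {Fin g} k | fe | maxLen-replicate-[] {Fin g} k | map-headM-replicate {Fin g} k = refl
  graph-sound-flush (just y) v (_ ∷ u) s E an acc | just z | true = ⊥-elim (graphFinal-dead u acc)
  graph-sound-flush (just y) v u s E an acc | just z | false = ⊥-elim (graphFinal-dead u acc)
  graph-sound-flush y v u s E an acc | nothing = ⊥-elim (graphFinal-dead u acc)

  graph-sound : ∀ u s E → graphFinal (foldl graphStep (just (just (s , E))) u) ≡ true → InGraph u s E
  graph-sound [] s E acc = V.replicate k [] , Ended-replicate E , goal
    where
      goal : [] ≡ conv (runMealy s (conv (V.replicate k [])) ∷ V.replicate k [])
      goal rewrite conv-replicate-[] {Fin g} k | is-nothing⇒nothing (flush s) acc = sym (conv-replicate-[] {Fin g} (suc k))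
  graph-sound ((y ∷ v) ∷ u) s E acc with allNothing v in an
  ... | true = graph-sound-flush y v u s E an acc
  ... | false with respectsEnded E v in ce
  ...   | false = ⊥-elim (graphFinal-dead u acc)
  ...   | true with step s v in sv
  ...     | (s' , o) with y
  ...       | nothing = ⊥-elim (graphFinal-dead u acc)
  ...       | just y' with does (o ≟ y') in oy
  ...         | false = ⊥-elim (graphFinal-dead u acc)
  ...         | true with graph-sound u s' (markEnded E v) acc
  ...           | (xs' , ok' , eq') = zipWith consM v xs' , Ended-zipWith-consM E v xs' ce ok' , goal
    where
      goal : (just y' ∷ v) ∷ u ≡ conv (runMealy s (conv (zipWith consM v xs')) ∷ zipWith consM v xs')
      goal rewrite conv-zipWith-consM E v xs' an ok' | sv | ≟-true⇒≡ o y' oy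
                 | conv-zipWith-consM {Fin g} (false ∷ E) (just y' ∷ v) (runMealy s' (conv xs') ∷ xs') refl ok'
                 = cong ((just y' ∷ v) ∷_) eq'

  graph-complete : ∀ m xs s E → maxLen xs ≡ m → Ended E xs →
             graphFinal (foldl graphStep (just (just (s , E))) (conv (runMealy s (conv xs) ∷ xs))) ≡ true
  graph-complete zero xs s E ml ok rewrite maxLen≡0⇒replicate xs ml | conv-replicate-[] {Fin g} k with flush s in fe
  ... | nothing rewrite conv-replicate-[] {Fin g} (suc k) | fe = refl
  ... | just z rewrite maxLen-replicate-[] {Fin g} k | map-headM-replicate {Fin g} k | allNothing-replicate {Fin g} k | fe | dec-true (z ≟ z) refl = refl
  graph-complete (suc m) xs s E ml ok
    rewrite conv-suc xs m ml
          | conv-cons (proj₂ (step s (V.map headM xs))) (runMealy (proj₁ (step s (V.map headM xs))) (conv (V.map tailL xs))) xs m ml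
          | maxLen-suc⇒heads-not-allNothing xs m ml | respectsEnded-heads E xs ok | dec-true (proj₂ (step s (V.map headM xs)) ≟ proj₂ (step s (V.map headM xs))) refl
          = graph-complete m (V.map tailL xs) (proj₁ (step s (V.map headM xs))) (markEnded E (V.map headM xs))
                     (trans (maxLen-tail xs) (cong pred ml)) (Ended-tails E xs ok)

  automatic : AutoFun g k
  automatic = record
    { fn = fun
    ; dfa = dfaOf finite-GraphState (just (just (s0 , V.replicate k false))) graphStep graphFinal
    ; recognisesGraph = λ u →
        (λ acc → let r = graph-sound u s0 (V.replicate k false)
                           (trans (sym (accepts-dfaOf finite-GraphState (just (just (s0 , V.replicate k false))) graphStep graphFinal u)) acc)
                 in proj₁ r , proj₂ (proj₂ r))
      , λ { (xs , refl) → trans (accepts-dfaOf finite-GraphState (just (just (s0 , V.replicate k false))) graphStep graphFinal (conv (fun xs ∷ xs)))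
                               (graph-complete (maxLen xs) xs s0 (V.replicate k false) refl (Ended-none xs)) }
    }
    where
      Ended-none : ∀ {k} (xs : Vec (List (Fin g)) k) → Ended (V.replicate k false) xs
      Ended-none [] = tt
      Ended-none (_ ∷ xs) = Ended-none xs

module _ {A : Set} where
  track₁ : A → Vec (Maybe A) 1
  track₁ a = just a ∷ []

  convN-track₁ : (x : List A) → convN (length x) (x ∷ []) ≡ map track₁ x
  convN-track₁ [] = refl
  convN-track₁ (a ∷ x) = cong (track₁ a ∷_) (convN-track₁ x)

  conv-track₁ : (x : List A) → conv (x ∷ []) ≡ map track₁ x
  conv-track₁ x rewrite ⊔-identityʳ (length x) = convN-track₁ x

module _ {g : ℕ} {S : Set} (F : Finite S) (s0 : S) (δ : S → Fin g → S) (fin : S → Bool) where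
  dfaPredicate : Vec (List (Fin g)) 1 → Bool
  dfaPredicate (x ∷ []) = fin (foldl δ s0 x)

  trackStep : Maybe S → Vec (Maybe (Fin g)) 1 → Maybe S
  trackStep (just s) (just a ∷ []) = just (δ s a)
  trackStep _ _ = nothing

  trackFinal : Maybe S → Bool
  trackFinal nothing = false
  trackFinal (just s) = fin s

  trackStep-dead : ∀ u → foldl trackStep nothing u ≡ nothing
  trackStep-dead [] = refl
  trackStep-dead (_ ∷ u) = trackStep-dead u

  trackStep-sound : ∀ u s → trackFinal (foldl trackStep (just s) u) ≡ true → Σ (List (Fin g)) λ x →
      (u ≡ map track₁ x) × (fin (foldl δ s x) ≡ true)
  trackStep-sound [] s acc = [] , refl , acc
  trackStep-sound ((just a ∷ []) ∷ u) s acc with trackStep-sound u (δ s a) acc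
  ... | x , e , f = a ∷ x , cong (track₁ a ∷_) e , f
  trackStep-sound ((nothing ∷ []) ∷ u) s acc rewrite trackStep-dead u = ⊥-elim (true≢false (sym acc))

  trackStep-foldl : ∀ x s → foldl trackStep (just s) (map track₁ x) ≡ just (foldl δ s x)
  trackStep-foldl [] s = refl
  trackStep-foldl (a ∷ x) s = trackStep-foldl x (δ s a)

  dfaAutoPred : AutoPred g 1
  dfaAutoPred = record
    { pred = dfaPredicate
    ; dfa = dfaOf (finite-Maybe F) (just s0) trackStep trackFinal
    ; recognises = λ u →
        (λ acc → let r = trackStep-sound u s0 (trans (sym (accepts-dfaOf (finite-Maybe F) (just s0) trackStep trackFinal u)) acc)
                 in (proj₁ r ∷ []) , trans (proj₁ (proj₂ r)) (sym (conv-track₁ (proj₁ r))) , proj₂ (proj₂ r))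
      , λ { ((x ∷ []) , refl , p) → trans (accepts-dfaOf (finite-Maybe F) (just s0) trackStep trackFinal (conv (x ∷ [])))
                                       (trans (cong (λ t → trackFinal (foldl trackStep (just s0) t)) (conv-track₁ x))
                                              (trans (cong trackFinal (trackStep-foldl x s0)) p)) }
    }

module _ {g : ℕ} (default : Fin g) where
  pick : Maybe (Fin g) → Maybe (Fin g) → Fin g
  pick _ (just y) = y
  pick (just x) nothing = x
  pick nothing nothing = default

  overlayMealy : Mealy g 2
  overlayMealy = record { S = ⊤ ; finS = finite-⊤ ; s0 = tt
               ; step = λ { st (a ∷ b ∷ []) → tt , pick a b } ; flush = λ _ → nothing }

  overlay : AutoFun g 2
  overlay = MealyFun.automatic overlayMealy

  zipPadded : List (Fin g) → List (Fin g) → List (Vec (Maybe (Fin g)) 2)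
  zipPadded [] _ = []
  zipPadded (a ∷ x) [] = (just a ∷ nothing ∷ []) ∷ zipPadded x []
  zipPadded (a ∷ x) (b ∷ y) = (just a ∷ just b ∷ []) ∷ zipPadded x y

  convN-pair : ∀ x y → length y ≤ length x → convN (length x) (x ∷ y ∷ []) ≡ zipPadded x y
  convN-pair [] [] _ = refl
  convN-pair (a ∷ x) [] _ = cong (_ ∷_) (convN-pair x [] z≤n)
  convN-pair (a ∷ x) (b ∷ y) (s≤s le) = cong (_ ∷_) (convN-pair x y le)

  runMealy-overlay : ∀ x y → length y ≤ length x → MealyFun.runMealy overlayMealy tt (zipPadded x y) ≡ y ++ drop (length y) x
  runMealy-overlay [] [] _ = refl
  runMealy-overlay (a ∷ x) [] _ = cong (a ∷_) (runMealy-overlay x [] z≤n)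
  runMealy-overlay (a ∷ x) (b ∷ y) (s≤s le) = cong (b ∷_) (runMealy-overlay x y le)

  overlay-fun : ∀ x y → length y ≤ length x → AutoFun.fn overlay (x ∷ y ∷ []) ≡ y ++ drop (length y) x
  overlay-fun x y le rewrite ⊔-identityʳ (length y) | m≥n⇒m⊔n≡m le | convN-pair x y le = runMealy-overlay x y le

-- Tape cells and cellwise transducers

record CellMachine (C : Set) : Set₁ where
  field
    S : Set
    finS : Finite S
    s0 : S
    step : S → C → S × C
    flush : S → Maybe C

module CellRun {C : Set} (M : CellMachine C) where
  open CellMachine M
  runCells : S → List C → List C
  runCells s [] = fromMaybe (flush s)
  runCells s (c ∷ t) = proj₂ (step s c) ∷ runCells (proj₁ (step s c)) t

  stateAt : S → (ℕ → C) → ℕ → S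
  stateAt s f zero = s
  stateAt s f (suc p) = stateAt (proj₁ (step s (f 0))) (λ q → f (suc q)) p

  stateAt-suc : ∀ s f p → stateAt s f (suc p) ≡ proj₁ (step (stateAt s f p) (f p))
  stateAt-suc s f zero = refl
  stateAt-suc s f (suc p) = stateAt-suc (proj₁ (step s (f 0))) (λ q → f (suc q)) p

  runCells-applyUpTo : ∀ (L : ℕ) s f → flush (stateAt s f L) ≡ nothing →
             runCells s (applyUpTo f L) ≡ applyUpTo (λ p → proj₂ (step (stateAt s f p) (f p))) L
  runCells-applyUpTo zero s f e rewrite e = refl
  runCells-applyUpTo (suc L) s f e = cong (_ ∷_) (runCells-applyUpTo L _ _ e)

  stateAt-local : ∀ (h : C → S) → (∀ st c → proj₁ (step st c) ≡ h c) → ∀ s f p → stateAt s f (suc p) ≡ h (f p)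
  stateAt-local h e s f p = trans (stateAt-suc s f p) (e _ _)

module Cells (s N : ℕ) where
  -- The cell for the factor of w of length m ending at position e: gen holds the nonterminals
  -- known to derive it, genLeft those deriving the left part of the current split of the
  -- factor whose right part is this one, and mark selects the length treated by the current
  -- stage. The other fields serve to lay out the tape and to feed in the letters.
  record Cell : Set where
    constructor cell
    field
      letter   : Maybe (Fin s)
      isFirst  : Bool
      isLast   : Bool
      letterIn : Maybe (Fin s)
      mark     : Bool
      gen      : Vec Bool N
      genLeft  : Vec Bool N
  open Cell public

  blank : Cell
  blank = cell nothing false false nothing false (V.replicate N false) (V.replicate N false)

  CellTuple : Set
  CellTuple = Maybe (Fin s) × Bool × Bool × Maybe (Fin s) × Bool × Vec Bool N × Vec Bool N

  toTuple : Cell → CellTuple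
  toTuple (cell a b c d e f h) = a , b , c , d , e , f , h
  fromTuple : CellTuple → Cell
  fromTuple (a , b , c , d , e , f , h) = cell a b c d e f h

  finite-CellTuple : Finite CellTuple
  finite-CellTuple =
      finite-× (finite-Maybe (finite-Fin s)) (finite-× finite-Bool (finite-× finite-Bool (finite-× (finite-Maybe (finite-Fin s))
         (finite-× finite-Bool (finite-× (finite-Vec finite-Bool N) (finite-Vec finite-Bool N))))))

  finite-Cell : Finite Cell
  finite-Cell = finite-retract finite-CellTuple toTuple fromTuple (λ _ → refl)

  t : ℕ
  t = size finite-Cell

  g : ℕ
  g = s + t

  encode : Cell → Fin g
  encode c = s ↑ʳ enc finite-Cell c

  rawLetter : Fin s → Fin g
  rawLetter a = a ↑ˡ t

  letterCell : Fin s → Cell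
  letterCell a = record blank { letter = just a }

  decode : Fin g → Cell
  decode x = [ letterCell , dec finite-Cell ]′ (splitAt s x)

  decodeM : Maybe (Fin g) → Cell
  decodeM nothing = blank
  decodeM (just x) = decode x

  decode-encode : ∀ c → decode (encode c) ≡ c
  decode-encode c rewrite splitAt-↑ʳ s t (enc finite-Cell c) = dec-enc finite-Cell c

  decode-rawLetter : ∀ a → decode (rawLetter a) ≡ letterCell a
  decode-rawLetter a rewrite splitAt-↑ˡ s a t = refl

  toMealy : CellMachine Cell → Mealy g 1
  toMealy M = record { S = S ; finS = finS ; s0 = s0
                     ; step = λ { st (m ∷ []) → proj₁ (step st (decodeM m)) , encode (proj₂ (step st (decodeM m))) }
                     ; flush = λ st → Maybe.map encode (flush st) }
    where open CellMachine M

  cellwise : CellMachine Cell → AutoFun g 1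
  cellwise M = MealyFun.automatic (toMealy M)

  module _ (M : CellMachine Cell) where
    open CellMachine M
    open CellRun M
    runMealy-map : ∀ {D : Set} (φ : D → Fin g) (ψ : D → Cell) → (∀ c → decode (φ c) ≡ ψ c) → ∀ st x →
             MealyFun.runMealy (toMealy M) st (map track₁ (map φ x)) ≡ map encode (runCells st (map ψ x))
    runMealy-map φ ψ dφ st [] with flush st
    ... | nothing = refl
    ... | just c = refl
    runMealy-map φ ψ dφ st (c ∷ x) rewrite dφ c = cong (_ ∷_) (runMealy-map φ ψ dφ _ x)

    cellwise-encode : ∀ x → AutoFun.fn (cellwise M) (map encode x ∷ []) ≡ map encode (runCells s0 x)
    cellwise-encode x rewrite conv-track₁ (map encode x) =
        trans (runMealy-map encode (λ c → c) decode-encode s0 x) (cong (λ z → map encode (runCells s0 z)) (map-id x))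

    cellwise-rawLetter : ∀ w → AutoFun.fn (cellwise M) (map rawLetter w ∷ []) ≡ map encode (runCells s0 (map letterCell w))
    cellwise-rawLetter w rewrite conv-track₁ (map rawLetter w) = runMealy-map rawLetter letterCell decode-rawLetter s0 w

  module _ {S : Set} (F : Finite S) (s0 : S) (δ : S → Cell → S) (fin : S → Bool) where
    cellPred : AutoPred g 1
    cellPred = dfaAutoPred F s0 (λ st x → δ st (decode x)) fin

    foldl-decode : ∀ {D : Set} (φ : D → Fin g) (ψ : D → Cell) → (∀ c → decode (φ c) ≡ ψ c) → ∀ st x →
               foldl (λ st x → δ st (decode x)) st (map φ x) ≡ foldl δ st (map ψ x)
    foldl-decode φ ψ dφ st [] = refl
    foldl-decode φ ψ dφ st (c ∷ x) rewrite dφ c = foldl-decode φ ψ dφ (δ st (ψ c)) x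

    cellPred-encode : ∀ x → AutoPred.pred cellPred (map encode x ∷ []) ≡ fin (foldl δ s0 x)
    cellPred-encode x = cong fin (trans (foldl-decode encode (λ c → c) decode-encode s0 x) (cong (foldl δ s0) (map-id x)))

    cellPred-rawLetter : ∀ w → AutoPred.pred cellPred (map rawLetter w ∷ []) ≡ fin (foldl δ s0 (map letterCell w))
    cellPred-rawLetter w = cong fin (foldl-decode rawLetter letterCell decode-rawLetter s0 w)

-- Boolean grammars

module GrammarStep {s : ℕ} (G : BNFGrammar s) where
  open BNFGrammar G

  termDerives : Maybe (Fin s) → Fin n → Bool
  termDerives nothing A = false
  termDerives (just a) A = any (λ r → ⌊ proj₁ r ≟ A ⌋ ∧ ⌊ proj₂ r ≟ a ⌋) termRules

  longRuleFires : (Fin n × Fin n → Bool) → Fin n → LongRule n → Bool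
  longRuleFires cc A r = ⌊ LongRule.lhs r ≟ A ⌋ ∧ all cc (toList (LongRule.pos r)) ∧ all (λ p → not (cc p)) (LongRule.neg r)

  derivesVia : Maybe (Fin s) → (Fin n × Fin n → Bool) → Fin n → Bool
  derivesVia ml cc A = termDerives ml A ∨ any (longRuleFires cc A) longRules

  single : List (Fin s) → Maybe (Fin s)
  single (a ∷ []) = just a
  single _ = nothing

  concatIn : (List (Fin s) → Fin n → Bool) → List (Fin s) → Fin n × Fin n → Bool
  concatIn m w (B , C) = any (λ uv → m (proj₁ uv) B ∧ m (proj₂ uv) C) (splits w)

module Fuel {s : ℕ} (G : BNFGrammar s) where
  open BNFGrammar G
  open GrammarStep G

  derivesVia-cong : ∀ ml cc cc' A → (∀ p → cc p ≡ cc' p) → derivesVia ml cc A ≡ derivesVia ml cc' A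
  derivesVia-cong ml cc cc' A e = cong (termDerives ml A ∨_) (any-cong (longRuleFires cc A) (longRuleFires cc' A) longRules
    (λ r → cong (λ z → ⌊ LongRule.lhs r ≟ A ⌋ ∧ z)
       (cong₂ _∧_ (all-cong cc cc' (toList (LongRule.pos r)) e) (all-cong (λ p → not (cc p)) (λ p → not (cc' p)) (LongRule.neg r) (λ p → cong not (e p))))))

  memN-nil : ∀ k A → memN G k [] A ≡ false
  memN-nil zero A = refl
  memN-nil (suc k) A = refl

  concatIn-fuel : ∀ k1 k2 u → length u ≤ suc k1 → length u ≤ suc k2 → ∀ p →
      concatIn (memN G k1) u p ≡ concatIn (memN G k2) u p

  memN-fuel : ∀ k1 k2 v A → length v ≤ k1 → length v ≤ k2 → memN G k1 v A ≡ memN G k2 v A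
  memN-fuel k1 k2 [] A _ _ = trans (memN-nil k1 A) (sym (memN-nil k2 A))
  memN-fuel (suc k1) (suc k2) (a ∷ []) A l1 l2 =
    derivesVia-cong (just a) (concatIn (memN G k1) (a ∷ [])) (concatIn (memN G k2) (a ∷ [])) A (concatIn-fuel k1 k2 (a ∷ []) l1 l2)
  memN-fuel (suc k1) (suc k2) (a ∷ b ∷ v) A l1 l2 =
    derivesVia-cong nothing (concatIn (memN G k1) (a ∷ b ∷ v)) (concatIn (memN G k2) (a ∷ b ∷ v)) A (concatIn-fuel k1 k2 (a ∷ b ∷ v) l1 l2)

  concatIn-fuel k1 k2 u l1 l2 (B , C) = any-cong-All (ProperSplit u) _ _ (splits u) (splits-proper u)
        (λ { (u1 , u2) (p1 , p2) → cong₂ _∧_ (memN-fuel k1 k2 u1 B (≤-pred (≤-trans p1 l1)) (≤-pred (≤-trans p1 l2)))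
                                             (memN-fuel k1 k2 u2 C (≤-pred (≤-trans p2 l1)) (≤-pred (≤-trans p2 l2))) })

-- The register machine

module _ {s : ℕ} (M : DARM s) (w : List (Fin s)) where
  open DARM M

  run-apply : ∀ k pc ρ {k′ i js} {F : AutoFun (s + t) k′} → prog pc ≡ apply i js F →
              run M w (suc k) (just pc) ρ ≡ run M w k (nextPC pc) (ρ V.[ i ]≔ AutoFun.fn F (V.map (lookup ρ) js))
  run-apply k pc ρ eq with prog pc | eq
  ... | _ | refl = refl

  run-ifGoto : ∀ k pc ρ {k′ js ℓ} {P : AutoPred (s + t) k′} → prog pc ≡ ifGoto js P ℓ →
               run M w (suc k) (just pc) ρ
                 ≡ (if AutoPred.pred P (V.map (lookup ρ) js) then run M w k (just ℓ) ρ else run M w k (nextPC pc) ρ)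
  run-ifGoto k pc ρ eq with prog pc | eq
  ... | _ | refl = refl

  run-copy : ∀ k pc ρ {i j} → prog pc ≡ copy i j →
      run M w (suc k) (just pc) ρ ≡ run M w k (nextPC pc) (ρ V.[ i ]≔ lookup ρ j)
  run-copy k pc ρ eq with prog pc | eq
  ... | _ | refl = refl

  run-goto : ∀ k pc ρ {ℓ} → prog pc ≡ goto ℓ → run M w (suc k) (just pc) ρ ≡ run M w k (just ℓ) ρ
  run-goto k pc ρ eq with prog pc | eq
  ... | _ | refl = refl

module Program {s : ℕ} (G : BNFGrammar s) where
  open BNFGrammar G renaming (n to N)
  open Cells s N public
  open GrammarStep G public

  noPairs : Vec (Vec Bool N) N
  noPairs = V.replicate N (V.replicate N false)

  isJustTrue : Maybe Bool → Bool
  isJustTrue (just true) = true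
  isJustTrue _ = false

  nextClass : Maybe Bool → Maybe Bool
  nextClass nothing = just true
  nextClass (just _) = just false

  layBase : CellMachine Cell
  layBase = record { S = Maybe Bool ; finS = finite-Maybe finite-Bool ; s0 = nothing
                 ; step = λ st c → nextClass st , record blank { letter = letter c ; isFirst = isJustTrue st }
                 ; flush = λ st → just (record blank { isFirst = isJustTrue st ; isLast = true }) }

  makeCounter : CellMachine Cell
  makeCounter = record { S = Bool ; finS = finite-Bool ; s0 = true
                ; step = λ b c → false , record blank { mark = b } ; flush = λ _ → nothing }

  shiftIn : CellMachine Cell
  shiftIn = record { S = Cell ; finS = finite-Cell ; s0 = blank ; step = λ st c → c , st ; flush = λ st → just st }

  shiftAlong : CellMachine Cell
  shiftAlong = record { S = Cell ; finS = finite-Cell ; s0 = blank ; step = λ st c → c , st ; flush = λ _ → nothing }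

  shiftLetters : CellMachine Cell
  shiftLetters = record { S = Maybe (Fin s) ; finS = finite-Maybe (finite-Fin s) ; s0 = nothing
                  ; step = λ st c → letter c , record c { letter = st } ; flush = λ _ → nothing }

  initialise : CellMachine Cell
  initialise = record { S = Maybe (Fin s) ; finS = finite-Maybe (finite-Fin s) ; s0 = nothing
                 ; step = λ st c → (if isLast c then letter c else st)
                                , record blank { isFirst = isFirst c ; letterIn = (if isFirst c then st else nothing) ; mark = isFirst c }
                 ; flush = λ _ → nothing }

  accumulate : Vec (Vec Bool N) N → Cell → Vec (Vec Bool N) N
  accumulate st c = tabulate (λ Y → tabulate (λ Z → lookup (lookup st Y) Z ∨ (lookup (genLeft c) Y ∧ lookup (gen c) Z)))

  newGen : Vec (Vec Bool N) N → Cell → Vec Bool N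
  newGen st c = tabulate (λ X → derivesVia (letterIn c) (λ p → lookup (lookup st (proj₁ p)) (proj₂ p)) X)

  columnStep : Vec (Vec Bool N) N → Cell → Vec (Vec Bool N) N × Cell
  columnStep st c = if mark c then (noPairs , record c { gen = newGen st c }) else (accumulate st c , c)

  computeColumn : CellMachine Cell
  computeColumn = record { S = Vec (Vec Bool N) N ; finS = finite-Vec (finite-Vec finite-Bool N) N ; s0 = noPairs
                 ; step = columnStep ; flush = λ _ → nothing }

  shiftLeftParts : CellMachine Cell
  shiftLeftParts = record { S = Vec Bool N ; finS = finite-Vec finite-Bool N ; s0 = V.replicate N false
                ; step = λ st c → genLeft c , record c { genLeft = st } ; flush = λ _ → nothing }

  carry : CellMachine Cell
  carry = record { S = Vec Bool N ; finS = finite-Vec finite-Bool N ; s0 = V.replicate N false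
                  ; step = λ st c → (if mark c then gen c else st) , (if isFirst c then record c { genLeft = st } else c)
                  ; flush = λ _ → nothing }

  advanceMark : CellMachine Cell
  advanceMark = record { S = Bool ; finS = finite-Bool ; s0 = false
                 ; step = λ st c → mark c , record c { mark = st } ; flush = λ _ → nothing }

  isEmpty unmarked letterless lastMarked lastHasStart : AutoPred g 1
  isEmpty = cellPred finite-Bool true (λ _ _ → false) (λ b → b)
  unmarked = cellPred finite-Bool true (λ b c → b ∧ not (mark c)) (λ b → b)
  letterless = cellPred finite-Bool true (λ b c → b ∧ is-nothing (letter c)) (λ b → b)
  lastMarked = cellPred finite-Bool false (λ _ c → mark c) (λ b → b)
  lastHasStart = cellPred finite-Bool false (λ _ c → lookup (gen c) start) (λ b → b)

  programLength : ℕ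
  programLength = 29

  Instruction : Set
  Instruction = Instr g 4 programLength

  rTape rBase rCounter rCounter₀ : Fin 4
  rTape = # 0
  rBase = # 1
  rCounter = # 2
  rCounter₀ = # 3

  applyCellwise : CellMachine Cell → Fin 4 → Fin 4 → Instruction
  applyCellwise M dst src = apply dst (src ∷ []) (cellwise M)

  program : Vec Instruction programLength
  program =
      read rBase                                                  -- 0
    ∷ ifGoto (rBase ∷ []) isEmpty (# 28)                          -- 1
    ∷ applyCellwise layBase rBase rBase                           -- 2
    ∷ applyCellwise makeCounter rCounter₀ rBase                   -- 3
    ∷ copy rCounter rCounter₀                                     -- 4
    ∷ applyCellwise shiftIn rTape rTape                           -- 5
    ∷ applyCellwise shiftAlong rCounter rCounter                  -- 6
    ∷ ifGoto (rCounter ∷ []) unmarked (# 9)                       -- 7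
    ∷ goto (# 5)                                                  -- 8
    ∷ apply rTape (rTape ∷ rBase ∷ []) (overlay (encode blank))   -- 9
    ∷ applyCellwise shiftLetters rBase rBase                      -- 10
    ∷ ifGoto (rBase ∷ []) letterless (# 13)                       -- 11
    ∷ goto (# 4)                                                  -- 12
    ∷ applyCellwise initialise rTape rTape                        -- 13
    ∷ applyCellwise computeColumn rTape rTape                     -- 14
    ∷ ifGoto (rTape ∷ []) lastMarked (# 25)                       -- 15
    ∷ copy rCounter rCounter₀                                     -- 16
    ∷ applyCellwise shiftLeftParts rTape rTape                    -- 17
    ∷ applyCellwise shiftAlong rCounter rCounter                  -- 18
    ∷ ifGoto (rCounter ∷ []) unmarked (# 21)                      -- 19
    ∷ goto (# 17)                                                 -- 20
    ∷ applyCellwise shiftLeftParts rTape rTape                    -- 21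
    ∷ applyCellwise carry rTape rTape                             -- 22
    ∷ applyCellwise advanceMark rTape rTape                       -- 23
    ∷ goto (# 14)                                                 -- 24
    ∷ ifGoto (rTape ∷ []) lastHasStart (# 27)                     -- 25
    ∷ reject                                                      -- 26
    ∷ accept                                                      -- 27
    ∷ (if epsRule then accept else reject)                        -- 28
    ∷ []

  decider : DARM s
  decider = record { t = t ; r = 4 ; p = programLength ; prog = lookup program }

module Execution {s : ℕ} (G : BNFGrammar s) (w : List (Fin s)) where
  open Program G

  Registers : Set
  Registers = Vec (List (Fin g)) 4

  record Reach (f : ℕ) (a : Maybe (Fin programLength)) (ρ : Registers) (b : Maybe (Fin programLength)) (σ : Registers) : Set where
    constructor mkR
    field go : ∀ k → run decider w (f + k) a ρ ≡ run decider w k b σ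
  open Reach public

  infixr 5 _⟫_

  _⟫_ : ∀ {f h a ρ b σ c τ} → Reach f a ρ b σ → Reach h b σ c τ → Reach (f + h) a ρ c τ
  _⟫_ {f} {h} {a} {ρ} r₁ r₂ =
      mkR λ k → trans (cong (λ z → run decider w z a ρ) (+-assoc f h k)) (trans (go r₁ (h + k)) (go r₂ k))

  Reach-cast : ∀ {f h a ρ b σ} → f ≡ h → Reach f a ρ b σ → Reach h a ρ b σ
  Reach-cast refl r = r

  applyStep : ∀ pc {k i} {js : Vec (Fin 4) k} {F : AutoFun g k} {ρ v} → lookup program pc ≡ apply i js F →
              AutoFun.fn F (V.map (lookup ρ) js) ≡ v → Reach 1 (just pc) ρ (nextPC pc) (ρ V.[ i ]≔ v)
  applyStep pc {i = i} {ρ = ρ} eq fv = mkR λ k →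
    trans (run-apply decider w k pc ρ eq) (cong (λ v → run decider w k (nextPC pc) (ρ V.[ i ]≔ v)) fv)

  ifStep-yes : ∀ pc {k} {js : Vec (Fin 4) k} {ℓ} {Q : AutoPred g k} {ρ} → lookup program pc ≡ ifGoto js Q ℓ →
               AutoPred.pred Q (V.map (lookup ρ) js) ≡ true → Reach 1 (just pc) ρ (just ℓ) ρ
  ifStep-yes pc {ρ = ρ} eq q = mkR λ k → trans (run-ifGoto decider w k pc ρ eq) (cong (λ b → if b then _ else _) q)

  ifStep-no : ∀ pc {k} {js : Vec (Fin 4) k} {ℓ} {Q : AutoPred g k} {ρ} → lookup program pc ≡ ifGoto js Q ℓ →
              AutoPred.pred Q (V.map (lookup ρ) js) ≡ false → Reach 1 (just pc) ρ (nextPC pc) ρ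
  ifStep-no pc {ρ = ρ} eq q = mkR λ k → trans (run-ifGoto decider w k pc ρ eq) (cong (λ b → if b then _ else _) q)

  copyStep : ∀ pc {i j ρ} → lookup program pc ≡ copy i j → Reach 1 (just pc) ρ (nextPC pc) (ρ V.[ i ]≔ lookup ρ j)
  copyStep pc {ρ = ρ} eq = mkR λ k → run-copy decider w k pc ρ eq

  gotoStep : ∀ pc {ℓ ρ} → lookup program pc ≡ goto ℓ → Reach 1 (just pc) ρ (just ℓ) ρ
  gotoStep pc {ρ = ρ} eq = mkR λ k → run-goto decider w k pc ρ eq

-- Laying out the tape

module Counter {s : ℕ} (G : BNFGrammar s) where
  open Program G

  counterCell : ℕ → ℕ → Cell
  counterCell j m = record blank { mark = m ≡ᵇ j }

  runCells-shiftIn : ∀ st x → CellRun.runCells shiftIn st x ≡ st ∷ x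
  runCells-shiftIn st [] = refl
  runCells-shiftIn st (c ∷ x) = cong (st ∷_) (runCells-shiftIn c x)

  runCells-shiftAlong : ∀ L f →
      CellRun.runCells shiftAlong blank (applyUpTo f L) ≡ applyUpTo (λ p → CellRun.stateAt shiftAlong blank f p) L
  runCells-shiftAlong L f = CellRun.runCells-applyUpTo shiftAlong L blank f refl

  counter-shift : ∀ L j → CellRun.runCells shiftAlong blank (applyUpTo (counterCell j) L) ≡ applyUpTo (counterCell (suc j)) L
  counter-shift L j = trans (runCells-shiftAlong L (counterCell j)) (applyUpTo-cong L _ _ pt)
    where pt : ∀ p → p < L → CellRun.stateAt shiftAlong blank (counterCell j) p ≡ counterCell (suc j) p
          pt zero _ = refl
          pt (suc p) _ = CellRun.stateAt-local shiftAlong (λ c → c) (λ _ _ → refl) blank (counterCell j) p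

  counter-exhausted : ∀ L j → L ≤ j → foldl (λ b c → b ∧ not (mark c)) true (applyUpTo (counterCell j) L) ≡ true
  counter-exhausted L j le =
      foldl-∧-true (λ c → not (mark c)) L (counterCell j) (λ p lt → cong not (<⇒≡ᵇ-false p j (<-≤-trans lt le)))

  counter-running : ∀ L j → j < L → foldl (λ b c → b ∧ not (mark c)) true (applyUpTo (counterCell j) L) ≡ false
  counter-running L j lt = foldl-∧-witness (λ c → not (mark c)) L (counterCell j) j lt (cong not (≡ᵇ-refl j))

module Layout {s : ℕ} (G : BNFGrammar s) (w : List (Fin s)) where
  open Program G
  open Counter G

  n : ℕ
  n = length w

  W : ℕ
  W = suc n

  wAt : ℕ → Maybe (Fin s)
  wAt e = headM (drop e w)

  baseCell : ℕ → ℕ → Cell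
  baseCell k m = record blank { letter = (if k ≤ᵇ′ m then wAt (m ∸ k) else nothing) ; isFirst = m ≡ᵇ 1 ; isLast = m ≡ᵇ n }

  columnClass : ℕ → Maybe Bool
  columnClass zero = nothing
  columnClass (suc zero) = just true
  columnClass (suc (suc _)) = just false

  isJustTrue-columnClass : ∀ i → isJustTrue (columnClass i) ≡ (i ≡ᵇ 1)
  isJustTrue-columnClass zero = refl
  isJustTrue-columnClass (suc zero) = refl
  isJustTrue-columnClass (suc (suc i)) = refl

  nextClass-columnClass : ∀ i → nextClass (columnClass i) ≡ columnClass (suc i)
  nextClass-columnClass zero = refl
  nextClass-columnClass (suc zero) = refl
  nextClass-columnClass (suc (suc i)) = refl

  layBase-from : ∀ i (v : List (Fin s)) → CellRun.runCells layBase (columnClass i) (map letterCell v)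
             ≡ applyUpTo (λ p → record blank { letter = headM (drop p v) ; isFirst = i + p ≡ᵇ 1 ; isLast = p ≡ᵇ length v }) (suc (length v))
  layBase-from i [] rewrite isJustTrue-columnClass i | +-identityʳ i = refl
  layBase-from i (a ∷ v) rewrite isJustTrue-columnClass i | nextClass-columnClass i | +-identityʳ i =
    cong (_ ∷_) (trans (layBase-from (suc i) v) (applyUpTo-cong (suc (length v)) _ _ (λ p _ → cong (λ z → record blank { letter = headM (drop p v) ; isFirst = z ≡ᵇ 1 ; isLast = p ≡ᵇ length v }) (sym (+-suc i p)))))

  layBase-input : CellRun.runCells layBase nothing (map letterCell w) ≡ applyUpTo (baseCell 0) W
  layBase-input = layBase-from 0 w

  makeCounter-base : CellRun.runCells makeCounter true (applyUpTo (baseCell 0) W) ≡ applyUpTo (counterCell 0) W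
  makeCounter-base = trans (CellRun.runCells-applyUpTo makeCounter W true (baseCell 0) refl) (applyUpTo-cong W _ _ pt)
    where pt : ∀ p → p < W → record blank { mark = CellRun.stateAt makeCounter true (baseCell 0) p } ≡ counterCell 0 p
          pt zero _ = refl
          pt (suc p) _ =
              cong (λ z → record blank { mark = z }) (CellRun.stateAt-local makeCounter (λ _ → false) (λ _ _ → refl) true (baseCell 0) p)

  base-shift : ∀ k → CellRun.runCells shiftLetters nothing (applyUpTo (baseCell k) W) ≡ applyUpTo (baseCell (suc k)) W
  base-shift k = trans (CellRun.runCells-applyUpTo shiftLetters W nothing (baseCell k) refl) (applyUpTo-cong W _ _ pt)
    where pt : ∀ p → p < W →
              record (baseCell k p) { letter = CellRun.stateAt shiftLetters nothing (baseCell k) p } ≡ baseCell (suc k) p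
          pt zero _ = refl
          pt (suc p) _ rewrite CellRun.stateAt-local shiftLetters letter (λ _ _ → refl) nothing (baseCell k) p = refl

  base-letterful : 0 < n → ∀ k → k < W → foldl (λ b c → b ∧ is-nothing (letter c)) true (applyUpTo (baseCell k) W) ≡ false
  base-letterful ne k lt = foldl-∧-witness (λ c → is-nothing (letter c)) W (baseCell k) k lt e
    where e : is-nothing (letter (baseCell k k)) ≡ false
          e rewrite ≤ᵇ′-refl k | n∸n≡0 k = headM-nonempty w ne

  base-letterless : ∀ k → W ≤ k → foldl (λ b c → b ∧ is-nothing (letter c)) true (applyUpTo (baseCell k) W) ≡ true
  base-letterless k le = foldl-∧-true (λ c → is-nothing (letter c)) W (baseCell k) e
    where
      e : ∀ p → p < W → is-nothing (letter (baseCell k p)) ≡ true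
      e p lt rewrite >⇒≤ᵇ′-false k p (<-≤-trans lt le) = refl

  -- Tape position p = e * W + m stands for the factor of length m ending at position e of w;
  -- blockPos recovers (e , m) by counting, as a left-to-right scan of the tape does.
  nextPos : ℕ × ℕ → ℕ × ℕ
  nextPos (e , m) = if m ≡ᵇ n then (suc e , 0) else (e , suc m)

  blockPos : ℕ → ℕ × ℕ
  blockPos zero = 0 , 0
  blockPos (suc p) = nextPos (blockPos p)

  blockPos-first : ∀ p → p < W → blockPos p ≡ (0 , p)
  blockPos-first zero _ = refl
  blockPos-first (suc p) (s≤s lt) rewrite blockPos-first p (s≤s (<⇒≤ lt)) | <⇒≡ᵇ-false p n lt = refl

  nextPos-suc : ∀ e m → nextPos (suc e , m) ≡ (suc (proj₁ (nextPos (e , m))) , proj₂ (nextPos (e , m)))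
  nextPos-suc e m with m ≡ᵇ n
  ... | true = refl
  ... | false = refl

  blockPos-shift : ∀ p → blockPos (W + p) ≡ (suc (proj₁ (blockPos p)) , proj₂ (blockPos p))
  blockPos-shift zero rewrite +-identityʳ n | blockPos-first n ≤-refl | ≡ᵇ-refl n = refl
  blockPos-shift (suc p) =
      trans (cong blockPos (+-suc W p)) (trans (cong nextPos (blockPos-shift p)) (nextPos-suc (proj₁ (blockPos p)) (proj₂ (blockPos p))))

  blockPos-at : ∀ e m → m < W → blockPos (e * W + m) ≡ (e , m)
  blockPos-at zero m lt = blockPos-first m lt
  blockPos-at (suc e) m lt = trans (cong blockPos (+-assoc W (e * W) m)) (trans (blockPos-shift (e * W + m))
                           (cong (λ z → suc (proj₁ z) , proj₂ z) (blockPos-at e m lt)))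

round-cost : ∀ r n → (6 + 4 * n) + (2 + (r * (8 + 4 * n) + (7 + 4 * n))) ≡ suc r * (8 + 4 * n) + (7 + 4 * n)
round-cost = solve-∀

-- The exact step count plus a slack term equals 40 n², where n = suc n'.
total-cost : ∀ n' →
    (4 + ((suc n' * (8 + 4 * suc n') + (7 + 4 * suc n')) + (1 + (n' * (10 + 4 * suc n') + 2)))) + 2 + (32 * n' * n' + 46 * n' + 8) ≡ 40 * (suc n' * (suc n' * 1))
total-cost = solve-∀

module Rounds {s : ℕ} (G : BNFGrammar s) (w : List (Fin s)) where
  open Program G
  open Counter G
  open Layout G w
  open Execution G w public

  encodeAll : List Cell → List (Fin g)
  encodeAll = map encode

  counterReg : ℕ → List (Fin g)
  counterReg j = encodeAll (applyUpTo (counterCell j) W)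

  shiftIn-fun : ∀ x → AutoFun.fn (cellwise shiftIn) (encodeAll x ∷ []) ≡ encodeAll (blank ∷ x)
  shiftIn-fun x = trans (cellwise-encode shiftIn x) (cong encodeAll (runCells-shiftIn blank x))

  shiftAlong-counter : ∀ j → AutoFun.fn (cellwise shiftAlong) (counterReg j ∷ []) ≡ counterReg (suc j)
  shiftAlong-counter j =
      trans (cellwise-encode shiftAlong (applyUpTo (counterCell j) W)) (cong encodeAll (counter-shift W j))

  unmarked-exhausted : ∀ j → W ≤ j → AutoPred.pred unmarked (counterReg j ∷ []) ≡ true
  unmarked-exhausted j le =
      trans (cellPred-encode finite-Bool true (λ b c → b ∧ not (mark c)) (λ b → b) (applyUpTo (counterCell j) W)) (counter-exhausted W j le)

  unmarked-running : ∀ j → j < W → AutoPred.pred unmarked (counterReg j ∷ []) ≡ false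
  unmarked-running j lt =
      trans (cellPred-encode finite-Bool true (λ b c → b ∧ not (mark c)) (λ b → b) (applyUpTo (counterCell j) W)) (counter-running W j lt)

  padLoop : ∀ r j x B D → j + suc r ≡ W →
            Reach (3 + 4 * r) (just (# 5)) (encodeAll x ∷ B ∷ counterReg j ∷ D ∷ [])
                              (just (# 9)) (encodeAll (replicate (suc r) blank ++ x) ∷ B ∷ counterReg W ∷ D ∷ [])
  padLoop zero j x B D e =
    subst (λ J → Reach 3 (just (# 5)) (encodeAll x ∷ B ∷ counterReg j ∷ D ∷ [])
                         (just (# 9)) (encodeAll (blank ∷ x) ∷ B ∷ counterReg J ∷ D ∷ [])) 1+j≡W
      (applyStep (# 5) refl (shiftIn-fun x) ⟫ applyStep (# 6) refl (shiftAlong-counter j)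
        ⟫ ifStep-yes (# 7) refl (unmarked-exhausted (suc j) (≤-reflexive (sym 1+j≡W))))
    where
      1+j≡W : suc j ≡ W
      1+j≡W = trans (sym (+-comm j 1)) e
  padLoop (suc r) j x B D e =
    Reach-cast (sym (cong (3 +_) (*-suc 4 r)))
      (applyStep (# 5) refl (shiftIn-fun x) ⟫ applyStep (# 6) refl (shiftAlong-counter j)
        ⟫ ifStep-no (# 7) refl (unmarked-running (suc j) 1+j<W) ⟫ gotoStep (# 8) refl
        ⟫ subst (λ X → Reach (3 + 4 * r) (just (# 5)) (encodeAll (blank ∷ x) ∷ B ∷ counterReg (suc j) ∷ D ∷ [])
                                         (just (# 9)) (encodeAll X ∷ B ∷ counterReg W ∷ D ∷ []))
                (replicate-snoc (suc r) blank x) (padLoop r (suc j) (blank ∷ x) B D 1+j+[1+r]≡W))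
    where
      1+j+[1+r]≡W : suc j + suc r ≡ W
      1+j+[1+r]≡W = trans (sym (+-suc j (suc r))) e
      1+j<W : suc j < W
      1+j<W = subst (suc j <_) 1+j+[1+r]≡W (m<m+n (suc j) z<s)

  roundCell : ℕ → ℕ → Cell
  roundCell k p = baseCell (k ∸ suc (proj₁ (blockPos p))) (proj₂ (blockPos p))

  roundTape : ℕ → List Cell
  roundTape k = applyUpTo (roundCell k) (k * W)

  roundTape-suc : ∀ k → applyUpTo (baseCell k) W ++ roundTape k ≡ roundTape (suc k)
  roundTape-suc k = sym (trans (applyUpTo-+ W (k * W) (roundCell (suc k)))
                (cong₂ _++_ (applyUpTo-cong W _ _ (λ p lt → cong (λ z → baseCell (suc k ∸ suc (proj₁ z)) (proj₂ z)) (blockPos-first p lt)))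
                            (applyUpTo-cong (k * W) _ _ (λ p _ → cong (λ z → baseCell (suc k ∸ suc (proj₁ z)) (proj₂ z)) (blockPos-shift p)))))

  baseReg : ℕ → List (Fin g)
  baseReg k = encodeAll (applyUpTo (baseCell k) W)

  drop-replicate : ∀ r (b : Cell) X → drop r (encodeAll (replicate r b ++ X)) ≡ encodeAll X
  drop-replicate zero b X = refl
  drop-replicate (suc r) b X = drop-replicate r b X

  length-encodeAll-applyUpTo : ∀ L f → length (encodeAll (applyUpTo f L)) ≡ L
  length-encodeAll-applyUpTo L f = trans (length-map encode (applyUpTo f L)) (length-applyUpTo f L)

  length-encodeAll-replicate : ∀ r (b : Cell) X → r ≤ length (encodeAll (replicate r b ++ X))
  length-encodeAll-replicate zero b X = z≤n
  length-encodeAll-replicate (suc r) b X = s≤s (length-encodeAll-replicate r b X)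

  overlay-round : ∀ k →
      AutoFun.fn (overlay (encode blank)) (encodeAll (replicate W blank ++ roundTape k) ∷ baseReg k ∷ []) ≡ encodeAll (roundTape (suc k))
  overlay-round k = trans (overlay-fun (encode blank) (encodeAll (replicate W blank ++ roundTape k)) (baseReg k)
                   (subst (_≤ length (encodeAll (replicate W blank ++ roundTape k))) (sym (length-encodeAll-applyUpTo W (baseCell k))) (length-encodeAll-replicate W blank (roundTape k))))
           (trans (cong (λ z → baseReg k ++ drop z (encodeAll (replicate W blank ++ roundTape k))) (length-encodeAll-applyUpTo W (baseCell k)))
           (trans (cong (baseReg k ++_) (drop-replicate W blank (roundTape k)))
           (trans (sym (map-++ encode (applyUpTo (baseCell k) W) (roundTape k))) (cong encodeAll (roundTape-suc k)))))

  shiftLetters-fun : ∀ k → AutoFun.fn (cellwise shiftLetters) (baseReg k ∷ []) ≡ baseReg (suc k)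
  shiftLetters-fun k = trans (cellwise-encode shiftLetters (applyUpTo (baseCell k) W)) (cong encodeAll (base-shift k))

  letterless-done : ∀ k → W ≤ k → AutoPred.pred letterless (baseReg k ∷ []) ≡ true
  letterless-done k le =
      trans (cellPred-encode finite-Bool true (λ b c → b ∧ is-nothing (letter c)) (λ b → b) (applyUpTo (baseCell k) W)) (base-letterless k le)

  letterless-running : 0 < n → ∀ k → k < W → AutoPred.pred letterless (baseReg k ∷ []) ≡ false
  letterless-running ne k lt =
      trans (cellPred-encode finite-Bool true (λ b c → b ∧ is-nothing (letter c)) (λ b → b) (applyUpTo (baseCell k) W)) (base-letterful ne k lt)

  round : ∀ k C → Reach (6 + 4 * n) (just (# 4)) (encodeAll (roundTape k) ∷ baseReg k ∷ C ∷ counterReg 0 ∷ [])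
                                   (just (# 11)) (encodeAll (roundTape (suc k)) ∷ baseReg (suc k) ∷ counterReg W ∷ counterReg 0 ∷ [])
  round k C = Reach-cast (cong suc (+-comm (3 + 4 * n) 2))
    (copyStep (# 4) refl ⟫ padLoop n 0 (roundTape k) (baseReg k) (counterReg 0) refl
      ⟫ applyStep (# 9) refl (overlay-round k) ⟫ applyStep (# 10) refl (shiftLetters-fun k))

  rounds : 0 < n → ∀ r k C → k + suc r ≡ W →
           Reach (r * (8 + 4 * n) + (7 + 4 * n)) (just (# 4)) (encodeAll (roundTape k) ∷ baseReg k ∷ C ∷ counterReg 0 ∷ [])
                 (just (# 13)) (encodeAll (roundTape W) ∷ baseReg W ∷ counterReg W ∷ counterReg 0 ∷ [])
  rounds ne zero k C e =
    subst (λ K → Reach (7 + 4 * n) (just (# 4)) (encodeAll (roundTape k) ∷ baseReg k ∷ C ∷ counterReg 0 ∷ [])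
                       (just (# 13)) (encodeAll (roundTape K) ∷ baseReg K ∷ counterReg W ∷ counterReg 0 ∷ [])) 1+k≡W
      (Reach-cast (+-comm (6 + 4 * n) 1)
        (round k C ⟫ ifStep-yes (# 11) refl (letterless-done (suc k) (≤-reflexive (sym 1+k≡W)))))
    where
      1+k≡W : suc k ≡ W
      1+k≡W = trans (sym (+-comm k 1)) e
  rounds ne (suc r) k C e = Reach-cast (round-cost r n)
    (round k C ⟫ ifStep-no (# 11) refl (letterless-running ne (suc k) 1+k<W) ⟫ gotoStep (# 12) refl
      ⟫ rounds ne r (suc k) (counterReg W) 1+k+[1+r]≡W)
    where
      1+k+[1+r]≡W : suc k + suc r ≡ W
      1+k+[1+r]≡W = trans (sym (+-suc k (suc r))) e
      1+k<W : suc k < W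
      1+k<W = subst (suc k <_) 1+k+[1+r]≡W (m<m+n (suc k) z<s)

-- Computing the stages

module Factors {s : ℕ} (G : BNFGrammar s) (w : List (Fin s)) where
  open BNFGrammar G renaming (n to N)
  open GrammarStep G
  open Fuel G
  open Layout G w using (n; W; wAt)

  derives : List (Fin s) → Fin N → Bool
  derives u X = memN G (length u) u X

  factor : ℕ → ℕ → List (Fin s)
  factor i l = take l (drop i w)

  letterEndingAt : ℕ → Maybe (Fin s)
  letterEndingAt zero = nothing
  letterEndingAt (suc e) = wAt e

  letterInAt : ℕ → ℕ → Maybe (Fin s)
  letterInAt e m = if m ≡ᵇ 1 then letterEndingAt e else nothing

  -- The intended contents of gen and genLeft at block position (e , m) before stage l
  -- (genSpec l) and after it has been computed (genSpec (suc l)).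
  genSpec : ℕ → ℕ → ℕ → Fin N → Bool
  genSpec la e m X = (1 ≤ᵇ′ m) ∧ (m <ᵇ′ la) ∧ (m ≤ᵇ′ e) ∧ derives (factor (e ∸ m) m) X

  genLeftSpec : ℕ → ℕ → ℕ → Fin N → Bool
  genLeftSpec l e m Y = (1 ≤ᵇ′ m) ∧ (m <ᵇ′ l) ∧ (l ≤ᵇ′ e) ∧ derives (factor (e ∸ l) (l ∸ m)) Y

  splitSpec : ℕ → ℕ → Fin N × Fin N → Bool
  splitSpec l e q = anyBelow l (λ m → genLeftSpec l e m (proj₁ q) ∧ genSpec l e m (proj₂ q))

  length-factor : ∀ i l → i + l ≤ n → length (factor i l) ≡ l
  length-factor i l i+l≤n = length-take≡ l (drop i w) (subst (l ≤_) (sym (length-drop i w)) l≤n∸i)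
    where
      l≤n∸i : l ≤ n ∸ i
      l≤n∸i = subst (_≤ n ∸ i) (m+n∸m≡n i l) (∸-monoˡ-≤ i i+l≤n)

  take-factor : ∀ i j l → j ≤ l → take j (factor i l) ≡ factor i j
  take-factor i j l le = trans (take-take j l (drop i w)) (cong (λ z → take z (drop i w)) (m≤n⇒m⊓n≡m le))

  drop-factor : ∀ i j l → drop j (factor i l) ≡ factor (i + j) (l ∸ j)
  drop-factor i j l = trans (drop-take j l (drop i w)) (cong (take (l ∸ j)) (drop-drop i j w))

  single-long : ∀ (u : List (Fin s)) → 2 ≤ length u → single u ≡ nothing
  single-long (a ∷ b ∷ u) _ = refl
  single-long (a ∷ []) (s≤s ())

  single-take-1 : ∀ (xs : List (Fin s)) → single (take 1 xs) ≡ headM xs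
  single-take-1 [] = refl
  single-take-1 (a ∷ xs) = refl

  semStep-eq : ∀ m (u : List (Fin s)) A → 1 ≤ length u → semStep G m u A ≡ derivesVia (single u) (concatIn m u) A
  semStep-eq m (a ∷ []) A _ = refl
  semStep-eq m (a ∷ b ∷ u) A _ = refl

  derivesVia-nothing : ∀ X → derivesVia nothing (λ _ → false) X ≡ false
  derivesVia-nothing X = any-false (longRuleFires (λ _ → false) X) longRules
    (λ r → ∧-zeroʳ ⌊ LongRule.lhs r ≟ X ⌋)

  memN-derives : ∀ l' (v : List (Fin s)) A → length v ≤ l' → memN G l' v A ≡ derives v A
  memN-derives l' v A le = memN-fuel l' (length v) v A le ≤-refl

  module Split (l' e : ℕ) (en : e ≤ n) (le : suc l' ≤ e) where
    l : ℕ
    l = suc l'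
    i : ℕ
    i = e ∸ l
    u : List (Fin s)
    u = factor i l
    lenu : length u ≡ l
    lenu = length-factor i l (subst (_≤ n) (sym (m∸n+n≡m le)) en)

    concatIn⇒splitSpec : ∀ Y Z → concatIn (memN G l') u (Y , Z) ≡ true → splitSpec l e (Y , Z) ≡ true
    concatIn⇒splitSpec Y Z h with splits-witness (λ uv → memN G l' (proj₁ uv) Y ∧ memN G l' (proj₂ uv) Z) u h
    ... | (j , j1 , jl , fj) = anyBelow-intro l _ m' (∸-monoʳ-< j1 (<⇒≤ jl')) (∧-true bB aA)
      where
        jl' : j < l
        jl' = subst (j <_) lenu jl
        m' : ℕ
        m' = l ∸ j
        lm : l ∸ m' ≡ j
        lm = m∸[m∸n]≡n (<⇒≤ jl')
        m'1 : 1 ≤ m'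
        m'1 = m<n⇒0<n∸m jl'
        m'l : m' < l
        m'l = ∸-monoʳ-< j1 (<⇒≤ jl')
        p1 : memN G l' (take j u) Y ≡ true
        p1 = ∧-conicalˡ _ _ fj
        p2 : memN G l' (drop j u) Z ≡ true
        p2 = ∧-conicalʳ _ _ fj
        lenT : length (take j u) ≡ j
        lenT = length-take≡ j u (<⇒≤ jl)
        q1 : derives (factor i (l ∸ m')) Y ≡ true
        q1 = subst (λ z → derives (factor i z) Y ≡ true) (sym lm)
               (subst (λ z → derives z Y ≡ true) (take-factor i j l (<⇒≤ jl'))
                 (trans (sym (memN-derives l' (take j u) Y (subst (_≤ l') (sym lenT) (≤-pred jl')))) p1))
        lenD : length (drop j u) ≡ m'
        lenD = trans (length-drop j u) (cong (_∸ j) lenu)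
        dsub : drop j u ≡ factor (e ∸ m') m'
        dsub =
            trans (drop-factor i j l) (cong (λ z → factor z m') (trans (cong (i +_) (sym lm)) (∸-telescope e l m' (<⇒≤ m'l) le)))
        q2 : derives (factor (e ∸ m') m') Z ≡ true
        q2 = subst (λ z → derives z Z ≡ true) dsub
               (trans (sym (memN-derives l' (drop j u) Z (subst (_≤ l') (sym lenD) (≤-pred (subst (_≤ l) refl m'l))))) p2)
        bB : genLeftSpec l e m' Y ≡ true
        bB = ∧-true (≤⇒≤ᵇ′ 1 m' m'1) (∧-true (≤⇒≤ᵇ′ (suc m') l m'l) (∧-true (≤⇒≤ᵇ′ l e le) q1))
        aA : genSpec l e m' Z ≡ true
        aA = ∧-true (≤⇒≤ᵇ′ 1 m' m'1) (∧-true (≤⇒≤ᵇ′ (suc m') l m'l) (∧-true (≤⇒≤ᵇ′ m' e (≤-trans (<⇒≤ m'l) le)) q2))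

    splitSpec⇒concatIn : ∀ Y Z → splitSpec l e (Y , Z) ≡ true → concatIn (memN G l') u (Y , Z) ≡ true
    splitSpec⇒concatIn Y Z h with anyBelow-witness l _ h
    ... | (m' , m'l , fm) =
        splits-intro (λ uv → memN G l' (proj₁ uv) Y ∧ memN G l' (proj₂ uv) Z) u j j1 (subst (j <_) (sym lenu) jl) (∧-true p1 p2)
      where
        bB = ∧-conicalˡ (genLeftSpec l e m' Y) (genSpec l e m' Z) fm
        aA = ∧-conicalʳ (genLeftSpec l e m' Y) (genSpec l e m' Z) fm
        bB4 = ∧₄-true⇒ {1 ≤ᵇ′ m'} {m' <ᵇ′ l} {l ≤ᵇ′ e} {derives (factor i (l ∸ m')) Y} bB
        aA4 = ∧₄-true⇒ {1 ≤ᵇ′ m'} {m' <ᵇ′ l} {m' ≤ᵇ′ e} {derives (factor (e ∸ m') m') Z} aA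
        m'1 : 1 ≤ m'
        m'1 = ≤ᵇ′⇒≤ 1 m' (proj₁ bB4)
        q1 : derives (factor i (l ∸ m')) Y ≡ true
        q1 = proj₂ (proj₂ (proj₂ bB4))
        q2 : derives (factor (e ∸ m') m') Z ≡ true
        q2 = proj₂ (proj₂ (proj₂ aA4))
        j : ℕ
        j = l ∸ m'
        j1 : 1 ≤ j
        j1 = m<n⇒0<n∸m m'l
        jl : j < l
        jl = ∸-monoʳ-< m'1 (<⇒≤ m'l)
        lm : l ∸ j ≡ m'
        lm = m∸[m∸n]≡n (<⇒≤ m'l)
        lenT : length (take j u) ≡ j
        lenT = length-take≡ j u (subst (j ≤_) (sym lenu) (<⇒≤ jl))
        p1 : memN G l' (take j u) Y ≡ true
        p1 = trans (memN-derives l' (take j u) Y (subst (_≤ l') (sym lenT) (≤-pred jl)))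
                   (subst (λ z → derives z Y ≡ true) (sym (take-factor i j l (<⇒≤ jl))) q1)
        dsub : drop j u ≡ factor (e ∸ m') m'
        dsub = trans (drop-factor i j l) (cong₂ factor (∸-telescope e l m' (<⇒≤ m'l) le) lm)
        lenD : length (drop j u) ≡ m'
        lenD = trans (length-drop j u) (trans (cong (_∸ j) lenu) lm)
        p2 : memN G l' (drop j u) Z ≡ true
        p2 = trans (memN-derives l' (drop j u) Z (subst (_≤ l') (sym lenD) (≤-pred m'l)))
                   (subst (λ z → derives z Z ≡ true) (sym dsub) q2)

    concatIn≡splitSpec : ∀ q → concatIn (memN G l') u q ≡ splitSpec l e q
    concatIn≡splitSpec (Y , Z) = Bool-ext (concatIn⇒splitSpec Y Z) (splitSpec⇒concatIn Y Z)

  single-factor : ∀ l' e → suc l' ≤ e → length (factor (e ∸ suc l') (suc l')) ≡ suc l' →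
      single (factor (e ∸ suc l') (suc l')) ≡ letterInAt e (suc l')
  single-factor zero (suc e) _ _ = single-take-1 (drop e w)
  single-factor (suc l') e _ len = single-long _ (subst (2 ≤_) (sym len) (s≤s (s≤s z≤n)))

  derivesVia-splitSpec : ∀ l' e X → e ≤ n →
      derivesVia (letterInAt e (suc l')) (splitSpec (suc l') e) X ≡ genSpec (suc (suc l')) e (suc l') X
  derivesVia-splitSpec l' e X en with suc l' ≤? e
  ... | yes le =
        sym (trans (atop l' e X le) (trans (cong (λ k → memN G k u X) lenu)
            (trans (semStep-eq (memN G l') u X (subst (1 ≤_) (sym lenu) (s≤s z≤n)))
            (trans (cong (λ z → derivesVia z (concatIn (memN G l') u) X) (single-factor l' e le lenu))
                   (derivesVia-cong (letterInAt e (suc l')) _ _ X concatIn≡splitSpec)))))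
    where open Split l' e en le
          atop : ∀ l' e X → suc l' ≤ e → genSpec (suc (suc l')) e (suc l') X ≡ derives (factor (e ∸ suc l') (suc l')) X
          atop l' e X le rewrite ≤ᵇ′-refl l' | ≤⇒≤ᵇ′ (suc l') e le = refl
  ... | no nle = trans (trans (derivesVia-cong (letterInAt e (suc l')) (splitSpec (suc l') e) (λ _ → false) X
                 (λ q → anyBelow-false (suc l') _ (λ m → cong (_∧ genSpec (suc l') e m (proj₂ q)) (bfalse m (proj₁ q)))))
              (trans (cong (λ z → derivesVia z (λ _ → false) X) inpN) (derivesVia-nothing X))) (sym (afalse l' e X (≰⇒> nle)))
    where
      afalse : ∀ l' e X → e < suc l' → genSpec (suc (suc l')) e (suc l') X ≡ false
      afalse l' e X lt rewrite ≤ᵇ′-refl l' | >⇒≤ᵇ′-false (suc l') e lt = refl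
      bfalse : ∀ m Y → genLeftSpec (suc l') e m Y ≡ false
      bfalse m Y rewrite >⇒≤ᵇ′-false (suc l') e (≰⇒> nle) =
          ∧3-false (1 ≤ᵇ′ m) (m <ᵇ′ suc l') (derives (factor (e ∸ suc l') (suc l' ∸ m)) Y)
      inpN : letterInAt e (suc l') ≡ nothing
      inpN = inpN' l' e (≰⇒> nle)
        where inpN' : ∀ l' e → e < suc l' → letterInAt e (suc l') ≡ nothing
              inpN' zero zero _ = refl
              inpN' zero (suc e) (s≤s ())
              inpN' (suc l') e _ = refl

module Stages {s : ℕ} (G : BNFGrammar s) (w : List (Fin s)) where
  open Program G
  open BNFGrammar G using () renaming (n to N)
  open Counter G
  open Layout G w
  open Factors G w
  open Rounds G w using (roundCell; roundTape)

  blockPos-inv : ∀ p → (proj₂ (blockPos p) < W) × (proj₁ (blockPos p) * W + proj₂ (blockPos p) ≡ p)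
  blockPos-inv zero = s≤s z≤n , refl
  blockPos-inv (suc p) with blockPos-inv p
  ... | (lt , eq) with proj₂ (blockPos p) ≡ᵇ n in en
  ...   | true =
      s≤s z≤n , trans (+-identityʳ (W + proj₁ (blockPos p) * W)) (lemma (proj₁ (blockPos p) * W) (proj₂ (blockPos p)) (≡ᵇ-true⇒≡ _ _ en) eq)
    where lemma : ∀ a m → m ≡ n → a + m ≡ p → W + a ≡ suc p
          lemma a m refl e = trans (cong suc (+-comm n a)) (cong suc e)
  ...   | false = s≤s (≤∧≢⇒< (≤-pred lt) (λ e → true≢false (trans (sym (≡⇒≡ᵇ-true e)) en))) , trans (+-suc _ _) (cong suc eq)

  L : ℕ
  L = W * W

  blockPos-mono : ∀ p → proj₁ (blockPos p) ≤ proj₁ (blockPos (suc p))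
  blockPos-mono p with proj₂ (blockPos p) ≡ᵇ n
  ... | true = n≤1+n _
  ... | false = ≤-refl

  e-bound : ∀ p → p < L → proj₁ (blockPos p) ≤ n
  e-bound p lt = ≤-pred (*-cancelʳ-< W (proj₁ (blockPos p)) W
                   (≤-<-trans (subst (proj₁ (blockPos p) * W ≤_) (proj₂ (blockPos-inv p)) (m≤m+n _ _)) lt))

  stageCell : ℕ → ℕ → ℕ → ℕ → Cell
  stageCell la l e m =
      cell nothing (m ≡ᵇ 1) false (letterInAt e m) (m ≡ᵇ l) (tabulate (genSpec la e m)) (tabulate (genLeftSpec l e m))

  stageCellAt : ℕ → ℕ → ℕ → Cell
  stageCellAt la l p = stageCell la l (proj₁ (blockPos p)) (proj₂ (blockPos p))

  stageTape : ℕ → ℕ → List Cell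
  stageTape la l = applyUpTo (stageCellAt la l) L

  lastLetter-block : ∀ e m → m ≡ n → suc e ≤ n → (if n ∸ e ≤ᵇ′ m then wAt (m ∸ (n ∸ e)) else nothing) ≡ wAt e
  lastLetter-block e .n refl b rewrite ≤⇒≤ᵇ′ (n ∸ e) n (m∸n≤m n e) | m∸[m∸n]≡n {n} {e} (≤-trans (n≤1+n _) b) = refl

  initialise-state : ∀ p → proj₁ (blockPos p) ≤ n →
      CellRun.stateAt initialise nothing (roundCell W) p ≡ letterEndingAt (proj₁ (blockPos p))
  initialise-state zero _ = refl
  initialise-state (suc p) bnd =
      trans (CellRun.stateAt-suc initialise nothing (roundCell W) p) (step bnd (initialise-state p (≤-trans (blockPos-mono p) bnd)))
    where
      step : proj₁ (blockPos (suc p)) ≤ n →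
          CellRun.stateAt initialise nothing (roundCell W) p ≡ letterEndingAt (proj₁ (blockPos p)) →
             (if isLast (roundCell W p) then letter (roundCell W p) else CellRun.stateAt initialise nothing (roundCell W) p) ≡ letterEndingAt (proj₁ (blockPos (suc p)))
      step b ih with proj₂ (blockPos p) ≡ᵇ n in en
      ... | false = ih
      ... | true = lastLetter-block (proj₁ (blockPos p)) (proj₂ (blockPos p)) (≡ᵇ-true⇒≡ _ _ en) b

  genSpec-1 : ∀ e m X → genSpec 1 e m X ≡ false
  genSpec-1 e zero X = refl
  genSpec-1 e (suc m) X = refl

  genLeftSpec-1 : ∀ e m X → genLeftSpec 1 e m X ≡ false
  genLeftSpec-1 e zero X = refl
  genLeftSpec-1 e (suc m) X = refl

  initialise-tape : CellRun.runCells initialise nothing (roundTape W) ≡ stageTape 1 1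
  initialise-tape = trans (CellRun.runCells-applyUpTo initialise L nothing (roundCell W) refl) (applyUpTo-cong L _ _ pt)
    where
      pt : ∀ p → p < L →
          proj₂ (CellMachine.step initialise (CellRun.stateAt initialise nothing (roundCell W) p) (roundCell W p)) ≡ stageCellAt 1 1 p
      pt p lt rewrite initialise-state p (e-bound p lt) =
        cong₂ (λ a b → cell nothing (proj₂ (blockPos p) ≡ᵇ 1) false (letterInAt (proj₁ (blockPos p)) (proj₂ (blockPos p))) (proj₂ (blockPos p) ≡ᵇ 1) a b)
              (sym (tabulate-false _ (genSpec-1 (proj₁ (blockPos p)) (proj₂ (blockPos p)))))
              (sym (tabulate-false _ (genLeftSpec-1 (proj₁ (blockPos p)) (proj₂ (blockPos p)))))

  pairAt : Vec (Vec Bool N) N → Fin N → Fin N → Bool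
  pairAt st Y Z = lookup (lookup st Y) Z

  pairsBelow : ℕ → ℕ → ℕ → Fin N → Fin N → Bool
  pairsBelow l e m Y Z = (m ≤ᵇ′ l) ∧ anyBelow m (λ m' → genLeftSpec l e m' Y ∧ genSpec l e m' Z)

  pairAt-noPairs : ∀ Y Z → pairAt noPairs Y Z ≡ false
  pairAt-noPairs Y Z rewrite lookup-replicate Y (V.replicate N false) = lookup-replicate Z false

  pairAt-accumulate : ∀ st c Y Z → pairAt (accumulate st c) Y Z ≡ pairAt st Y Z ∨ (lookup (genLeft c) Y ∧ lookup (gen c) Z)
  pairAt-accumulate st c Y Z rewrite lookup∘tabulate (λ Y → tabulate (λ Z → lookup (lookup st Y) Z ∨ (lookup (genLeft c) Y ∧ lookup (gen c) Z))) Y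
    = lookup∘tabulate (λ Z → lookup (lookup st Y) Z ∨ (lookup (genLeft c) Y ∧ lookup (gen c) Z)) Z

  module NewColumn (l : ℕ) (ln : l ≤ n) where
    pairsBelowAt : ℕ × ℕ → Fin N → Fin N → Bool
    pairsBelowAt em = pairsBelow l (proj₁ em) (proj₂ em)

    pairsBelow-mark : ∀ e m Y Z → (m ≡ᵇ l) ≡ true → false ≡ pairsBelowAt (nextPos (e , m)) Y Z
    pairsBelow-mark e m Y Z em with m ≡ᵇ n
    ... | true = refl
    ... | false rewrite ≡ᵇ-true⇒≡ m l em | ≤ᵇ′-suc-self l = refl

    pairsBelow-unmarked : ∀ e m Y Z → (m ≡ᵇ l) ≡ false →
                pairsBelow l e m Y Z ∨ (genLeftSpec l e m Y ∧ genSpec l e m Z) ≡ pairsBelowAt (nextPos (e , m)) Y Z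
    pairsBelow-unmarked e m Y Z em with (suc m ≤ᵇ′ l) in lm
    ... | true rewrite <⇒≡ᵇ-false m n (≤-trans (≤ᵇ′⇒≤ (suc m) l lm) ln) | lm | sym (≤ᵇ′-suc-≢ m l em) | lm = refl
    ... | false rewrite sym (≤ᵇ′-suc-≢ m l em) | lm | ∧2-false (1 ≤ᵇ′ m) ((l ≤ᵇ′ e) ∧ derives (factor (e ∸ l) (l ∸ m)) Y) =
        aux (m ≡ᵇ n)
      where
        aux : ∀ b → false ≡ pairsBelowAt (if b then (suc e , 0) else (e , suc m)) Y Z
        aux true = refl
        aux false rewrite lm = refl

    computeColumn-state : ∀ p Y Z →
        pairAt (CellRun.stateAt computeColumn noPairs (stageCellAt l l) p) Y Z ≡ pairsBelowAt (blockPos p) Y Z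
    computeColumn-state zero Y Z = pairAt-noPairs Y Z
    computeColumn-state (suc p) Y Z =
        trans (cong (λ st → pairAt st Y Z) (CellRun.stateAt-suc computeColumn noPairs (stageCellAt l l) p)) (go (CellRun.stateAt computeColumn noPairs (stageCellAt l l) p) (computeColumn-state p Y Z))
      where
        go : ∀ st → pairAt st Y Z ≡ pairsBelowAt (blockPos p) Y Z →
            pairAt (proj₁ (columnStep st (stageCellAt l l p))) Y Z ≡ pairsBelowAt (blockPos (suc p)) Y Z
        go st ih with proj₂ (blockPos p) ≡ᵇ l in em
        ... | true = trans (pairAt-noPairs Y Z) (pairsBelow-mark (proj₁ (blockPos p)) (proj₂ (blockPos p)) Y Z em)
        ... | false = trans (pairAt-accumulate st (stageCellAt l l p) Y Z)
                        (trans (cong₂ (λ a b → a ∨ b) ih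
                                 (cong₂ _∧_ (lookup∘tabulate (genLeftSpec l (proj₁ (blockPos p)) (proj₂ (blockPos p))) Y)
                                            (lookup∘tabulate (genSpec l (proj₁ (blockPos p)) (proj₂ (blockPos p))) Z)))
                               (pairsBelow-unmarked (proj₁ (blockPos p)) (proj₂ (blockPos p)) Y Z em))

    open Fuel G using (derivesVia-cong)

    column-marked : ∀ l' → l ≡ suc l' → ∀ e m → e ≤ n → m ≡ l → ∀ st → (∀ Y Z → pairAt st Y Z ≡ pairsBelow l e m Y Z) →
           record (stageCell l l e m) { gen = newGen st (stageCell l l e m) } ≡ stageCell (suc l) l e m
    column-marked l' refl e .(suc l') en refl st h =
      cong (λ V → cell nothing (suc l' ≡ᵇ 1) false (letterInAt e (suc l')) (suc l' ≡ᵇ suc l') V (tabulate (genLeftSpec (suc l') e (suc l'))))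
           (tabulate-cong (λ X → trans (derivesVia-cong (letterInAt e (suc l')) _ (splitSpec (suc l') e) X hq) (derivesVia-splitSpec l' e X en)))
      where
        hq : ∀ q → pairAt st (proj₁ q) (proj₂ q) ≡ splitSpec (suc l') e q
        hq q = trans (h (proj₁ q) (proj₂ q)) (cong (λ b → b ∧ splitSpec (suc l') e q) (≤ᵇ′-refl (suc l')))

    column-unmarked : ∀ e m → (m ≡ᵇ l) ≡ false → stageCell l l e m ≡ stageCell (suc l) l e m
    column-unmarked e m em =
        cong (λ V → cell nothing (m ≡ᵇ 1) false (letterInAt e m) (m ≡ᵇ l) V (tabulate (genLeftSpec l e m)))
                       (tabulate-cong (λ X → cong (λ z → (1 ≤ᵇ′ m) ∧ (z ∧ ((m ≤ᵇ′ e) ∧ derives (factor (e ∸ m) m) X))) (≤ᵇ′-suc-≢ m l em)))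

    columnStep-cell : ∀ l' → l ≡ suc l' → ∀ e m → e ≤ n → ∀ st → (∀ Y Z → pairAt st Y Z ≡ pairsBelow l e m Y Z) →
                      proj₂ (columnStep st (stageCell l l e m)) ≡ stageCell (suc l) l e m
    columnStep-cell l' l≡1+l' e m e≤n st h = byMark (m ≡ᵇ l) refl
      where
        byMark : ∀ b → (m ≡ᵇ l) ≡ b → proj₂ (columnStep st (stageCell l l e m)) ≡ stageCell (suc l) l e m
        byMark true m≡l = trans (cong proj₂ (if-true (m ≡ᵇ l) _ _ m≡l))
                                (column-marked l' l≡1+l' e m e≤n (≡ᵇ-true⇒≡ _ _ m≡l) st h)
        byMark false m≢l = trans (cong proj₂ (if-false (m ≡ᵇ l) _ _ m≢l)) (column-unmarked e m m≢l)

    computeColumn-tape : ∀ l' → l ≡ suc l' → CellRun.runCells computeColumn noPairs (stageTape l l) ≡ stageTape (suc l) l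
    computeColumn-tape l' l≡1+l' =
        trans (CellRun.runCells-applyUpTo computeColumn L noPairs (stageCellAt l l) refl) (applyUpTo-cong L _ _ cellwise-ok)
      where
        cellwise-ok : ∀ p → p < L → proj₂ (columnStep (CellRun.stateAt computeColumn noPairs (stageCellAt l l) p) (stageCellAt l l p))
                                    ≡ stageCellAt (suc l) l p
        cellwise-ok p p<L = columnStep-cell l' l≡1+l' (proj₁ (blockPos p)) (proj₂ (blockPos p)) (e-bound p p<L)
                              (CellRun.stateAt computeColumn noPairs (stageCellAt l l) p) (computeColumn-state p)

  zeros : Vec Bool N
  zeros = V.replicate N false

  -- From stage l to stage l + 1 the left part for (e , m) is the left part for (e - 1 , m - 1),
  -- which lies W + 1 cells earlier on the tape; for m = 1 it is the factor of length l ending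
  -- at e - 1, whose set the carry machine copies over from column l of the previous block.
  module LeftShift (l : ℕ) where
    computed : ℕ → Cell
    computed = stageCellAt (suc l) l

    shiftedCell : ℕ → ℕ → Cell
    shiftedCell j p = record (computed p) { genLeft = if j ≤ᵇ′ p then genLeft (computed (p ∸ j)) else zeros }

    shiftedTape : ℕ → List Cell
    shiftedTape j = applyUpTo (shiftedCell j) L

    shB-step : ∀ j → CellRun.runCells shiftLeftParts zeros (shiftedTape j) ≡ shiftedTape (suc j)
    shB-step j = trans (CellRun.runCells-applyUpTo shiftLeftParts L zeros (shiftedCell j) refl) (applyUpTo-cong L _ _ pt)
      where pt : ∀ p → p < L →
                record (shiftedCell j p) { genLeft = CellRun.stateAt shiftLeftParts zeros (shiftedCell j) p } ≡ shiftedCell (suc j) p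
            pt zero _ = refl
            pt (suc q) _ rewrite CellRun.stateAt-local shiftLeftParts genLeft (λ _ _ → refl) zeros (shiftedCell j) q = refl

    fullyShifted : ℕ → Cell
    fullyShifted = shiftedCell (suc W)

    prevGen : ℕ → Vec Bool N
    prevGen zero = zeros
    prevGen (suc e) = tabulate (genSpec (suc l) e l)

    carried : ℕ × ℕ → Vec Bool N
    carried em = if proj₂ em ≤ᵇ′ l then prevGen (proj₁ em) else tabulate (genSpec (suc l) (proj₁ em) l)

    carried-mark : ∀ e → carried (nextPos (e , l)) ≡ tabulate (genSpec (suc l) e l)
    carried-mark e with l ≡ᵇ n
    ... | true = refl
    ... | false rewrite ≤ᵇ′-suc-self l = refl

    carried-unmarked : l ≤ n → ∀ e m → (m ≡ᵇ l) ≡ false → carried (e , m) ≡ carried (nextPos (e , m))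
    carried-unmarked ln e m ml with m ≡ᵇ n in mn
    ... | true rewrite ≡ᵇ-true⇒≡ m n mn | >⇒≤ᵇ′-false n l (≤∧≢⇒< ln (λ eq → true≢false (trans (sym (≡⇒≡ᵇ-true (sym eq))) ml))) = refl
    ... | false rewrite ≤ᵇ′-suc-≢ m l ml = refl

    carry-state : l ≤ n → ∀ p → CellRun.stateAt carry zeros fullyShifted p ≡ carried (blockPos p)
    carry-state ln zero = refl
    carry-state ln (suc p) = trans (CellRun.stateAt-suc carry zeros fullyShifted p) (sel (proj₂ (blockPos p) ≡ᵇ l) refl)
      where
        sel : ∀ b → (proj₂ (blockPos p) ≡ᵇ l) ≡ b →
              (if mark (fullyShifted p) then gen (fullyShifted p) else CellRun.stateAt carry zeros fullyShifted p) ≡ carried (blockPos (suc p))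
        sel true eq = trans (if-true (proj₂ (blockPos p) ≡ᵇ l) _ _ eq) (aux (proj₂ (blockPos p)) (≡ᵇ-true⇒≡ _ _ eq))
          where aux : ∀ m → m ≡ l →
                    tabulate (genSpec (suc l) (proj₁ (blockPos p)) m) ≡ carried (nextPos (proj₁ (blockPos p) , m))
                aux .l refl = sym (carried-mark (proj₁ (blockPos p)))
        sel false eq = trans (if-false (proj₂ (blockPos p) ≡ᵇ l) _ _ eq)
                         (trans (carry-state ln p) (carried-unmarked ln (proj₁ (blockPos p)) (proj₂ (blockPos p)) eq))

    carriedCell : ℕ → Cell
    carriedCell p = proj₂ (CellMachine.step carry (CellRun.stateAt carry zeros fullyShifted p) (fullyShifted p))

    carriedCell-genLeft : ∀ p →
        carriedCell p ≡ record (fullyShifted p) { genLeft = if proj₂ (blockPos p) ≡ᵇ 1 then CellRun.stateAt carry zeros fullyShifted p else genLeft (fullyShifted p) }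
    carriedCell-genLeft p = if-genLeft (proj₂ (blockPos p) ≡ᵇ 1)
      where
        if-genLeft : ∀ b →
            (if b then record (fullyShifted p) { genLeft = CellRun.stateAt carry zeros fullyShifted p } else fullyShifted p)
                           ≡ record (fullyShifted p) { genLeft = if b then CellRun.stateAt carry zeros fullyShifted p else genLeft (fullyShifted p) }
        if-genLeft true  = refl
        if-genLeft false = refl

    advanceMark-state : l < n → ∀ p → CellRun.stateAt advanceMark false carriedCell p ≡ (proj₂ (blockPos p) ≡ᵇ suc l)
    advanceMark-state ln zero = refl
    advanceMark-state ln (suc q) =
        trans (CellRun.stateAt-local advanceMark mark (λ _ _ → refl) false carriedCell q) (trans (cong mark (carriedCell-genLeft q)) (aux (blockPos q) refl))
      where aux : ∀ em → blockPos q ≡ em → (proj₂ em ≡ᵇ l) ≡ (proj₂ (nextPos em) ≡ᵇ suc l)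
            aux (e , m) _ with m ≡ᵇ n in mn
            ... | true rewrite ≡ᵇ-true⇒≡ m n mn = >⇒≡ᵇ-false n l ln
            ... | false = refl

    +-suc-∸-suc : ∀ a q → (a + suc q) ∸ suc a ≡ q
    +-suc-∸-suc zero q = refl
    +-suc-∸-suc (suc a) q = +-suc-∸-suc a q

    blockPos-W : blockPos W ≡ (1 , 0)
    blockPos-W = trans (cong blockPos (sym (+-identityʳ W))) (blockPos-shift 0)

    genLeft-shifted : l ≤ n → ∀ q → (proj₂ (blockPos (W + suc q)) ≡ᵇ 1) ≡ false →
              genLeft (computed ((W + suc q) ∸ suc W)) ≡ tabulate (genLeftSpec (suc l) (proj₁ (blockPos (W + suc q))) (proj₂ (blockPos (W + suc q))))
    genLeft-shifted ln q ne rewrite +-suc-∸-suc W q = aux (blockPos-shift (suc q)) ne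
      where
        aux : ∀ {em} → em ≡ (suc (proj₁ (nextPos (blockPos q))) , proj₂ (nextPos (blockPos q))) → (proj₂ em ≡ᵇ 1) ≡ false →
              tabulate (genLeftSpec l (proj₁ (blockPos q)) (proj₂ (blockPos q))) ≡ tabulate (genLeftSpec (suc l) (proj₁ em) (proj₂ em))
        aux refl ne' with proj₂ (blockPos q) ≡ᵇ n in mn
        ... | true = tabulate-cong (λ Y → bz (proj₁ (blockPos q)) (proj₂ (blockPos q)) (≡ᵇ-true⇒≡ _ _ mn) Y)
          where bz : ∀ e m → m ≡ n → ∀ Y → genLeftSpec l e m Y ≡ false
                bz e .n refl Y rewrite >⇒≤ᵇ′-false (suc n) l (s≤s ln) =
                    ∧2-false (1 ≤ᵇ′ n) ((l ≤ᵇ′ e) ∧ derives (factor (e ∸ l) (l ∸ n)) Y)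
        ... | false = aux2 (proj₂ (blockPos q)) ne'
          where aux2 : ∀ m → (suc m ≡ᵇ 1) ≡ false →
                    tabulate (genLeftSpec l (proj₁ (blockPos q)) m) ≡ tabulate (genLeftSpec (suc l) (suc (proj₁ (blockPos q))) (suc m))
                aux2 zero ()
                aux2 (suc m) _ = refl

    carried-first : 1 ≤ l → ∀ em → proj₂ em ≡ 1 → carried em ≡ tabulate (genLeftSpec (suc l) (proj₁ em) (proj₂ em))
    carried-first 1≤l (zero , .1) refl rewrite ≤⇒≤ᵇ′ 1 l 1≤l = sym (tabulate-false _ (λ Y → refl))
    carried-first 1≤l (suc e , .1) refl rewrite ≤⇒≤ᵇ′ 1 l 1≤l =
      tabulate-cong (λ Y → cong (λ z → z ∧ ((l ≤ᵇ′ e) ∧ derives (factor (e ∸ l) l) Y)) (≤ᵇ′-refl l))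

    genLeft-fullyShifted : l ≤ n → ∀ p → (proj₂ (blockPos p) ≡ᵇ 1) ≡ false →
        genLeft (fullyShifted p) ≡ tabulate (genLeftSpec (suc l) (proj₁ (blockPos p)) (proj₂ (blockPos p)))
    genLeft-fullyShifted l≤n p m≢1 with suc W ≤ᵇ′ p in W<p
    ... | true = via (p ∸ suc W) (sym p≡W+1+q)
      where
        p≡W+1+q : W + suc (p ∸ suc W) ≡ p
        p≡W+1+q = trans (+-suc W (p ∸ suc W)) (trans (cong suc (+-comm W (p ∸ suc W)))
                    (trans (sym (+-suc (p ∸ suc W) W)) (m∸n+n≡m (≤ᵇ′⇒≤ (suc W) p W<p))))
        via : ∀ q → p ≡ W + suc q →
              genLeft (computed (p ∸ suc W)) ≡ tabulate (genLeftSpec (suc l) (proj₁ (blockPos p)) (proj₂ (blockPos p)))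
        via q refl = genLeft-shifted l≤n q m≢1
    ... | false = atMost (m≤n⇒m<n∨m≡n (≤-pred p<1+W))
      where
        p<1+W : p < suc W
        p<1+W = ≰⇒> (λ h → true≢false (trans (sym (≤⇒≤ᵇ′ (suc W) p h)) W<p))
        atMost : (p < W) ⊎ (p ≡ W) → zeros ≡ tabulate (genLeftSpec (suc l) (proj₁ (blockPos p)) (proj₂ (blockPos p)))
        atMost (inj₁ p<W) rewrite blockPos-first p p<W =
          sym (tabulate-false _ (λ Y → ∧3-false (1 ≤ᵇ′ p) (suc p ≤ᵇ′ suc l) (derives (factor (0 ∸ suc l) (suc l ∸ p)) Y)))
        atMost (inj₂ refl) rewrite blockPos-W = sym (tabulate-false _ (λ Y → refl))

    genLeft-carried : 1 ≤ l → l ≤ n → ∀ p →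
        (if proj₂ (blockPos p) ≡ᵇ 1 then CellRun.stateAt carry zeros fullyShifted p else genLeft (fullyShifted p))
          ≡ tabulate (genLeftSpec (suc l) (proj₁ (blockPos p)) (proj₂ (blockPos p)))
    genLeft-carried 1≤l l≤n p with proj₂ (blockPos p) ≡ᵇ 1 in m≡1
    ... | true  = trans (carry-state l≤n p) (carried-first 1≤l (blockPos p) (≡ᵇ-true⇒≡ _ _ m≡1))
    ... | false = genLeft-fullyShifted l≤n p m≡1

    stage-tape : 1 ≤ l → l < n →
        CellRun.runCells advanceMark false (CellRun.runCells carry zeros (shiftedTape (suc W))) ≡ stageTape (suc l) (suc l)
    stage-tape l1 ln =
        trans (cong (CellRun.runCells advanceMark false) (CellRun.runCells-applyUpTo carry L zeros fullyShifted refl))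
                      (trans (CellRun.runCells-applyUpTo advanceMark L false carriedCell refl) (applyUpTo-cong L _ _ pt))
      where
        pt : ∀ p → p < L →
            record (carriedCell p) { mark = CellRun.stateAt advanceMark false carriedCell p } ≡ stageCellAt (suc l) (suc l) p
        pt p _ =
            trans (cong (λ c → record c { mark = CellRun.stateAt advanceMark false carriedCell p }) (carriedCell-genLeft p))
                   (cong₂ (λ M B → cell nothing (proj₂ (blockPos p) ≡ᵇ 1) false (letterInAt (proj₁ (blockPos p)) (proj₂ (blockPos p))) M
                                           (tabulate (genSpec (suc l) (proj₁ (blockPos p)) (proj₂ (blockPos p)))) B)
                          (advanceMark-state ln p) (genLeft-carried l1 (<⇒≤ ln) p))

module StageRuns {s : ℕ} (G : BNFGrammar s) (w : List (Fin s)) where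
  open Program G
  open Counter G
  open Layout G w
  open Factors G w
  open Stages G w
  open Rounds G w

  stageReg : ℕ → ℕ → List (Fin g)
  stageReg la l = encodeAll (stageTape la l)

  shiftLeftParts-fun : ∀ l j →
      AutoFun.fn (cellwise shiftLeftParts) (encodeAll (LeftShift.shiftedTape l j) ∷ []) ≡ encodeAll (LeftShift.shiftedTape l (suc j))
  shiftLeftParts-fun l j =
      trans (cellwise-encode shiftLeftParts (LeftShift.shiftedTape l j)) (cong encodeAll (LeftShift.shB-step l j))

  shiftLoop : ∀ l r j D E → j + suc r ≡ W →
              Reach (3 + 4 * r) (just (# 17)) (encodeAll (LeftShift.shiftedTape l j) ∷ D ∷ counterReg j ∷ E ∷ [])
                                (just (# 21)) (encodeAll (LeftShift.shiftedTape l W) ∷ D ∷ counterReg W ∷ E ∷ [])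
  shiftLoop l zero j D E e =
    subst (λ J → Reach 3 (just (# 17)) (encodeAll (LeftShift.shiftedTape l j) ∷ D ∷ counterReg j ∷ E ∷ [])
                         (just (# 21)) (encodeAll (LeftShift.shiftedTape l J) ∷ D ∷ counterReg J ∷ E ∷ [])) 1+j≡W
      (applyStep (# 17) refl (shiftLeftParts-fun l j) ⟫ applyStep (# 18) refl (shiftAlong-counter j)
        ⟫ ifStep-yes (# 19) refl (unmarked-exhausted (suc j) (≤-reflexive (sym 1+j≡W))))
    where
      1+j≡W : suc j ≡ W
      1+j≡W = trans (sym (+-comm j 1)) e
  shiftLoop l (suc r) j D E e =
    Reach-cast (sym (cong (3 +_) (*-suc 4 r)))
      (applyStep (# 17) refl (shiftLeftParts-fun l j) ⟫ applyStep (# 18) refl (shiftAlong-counter j)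
        ⟫ ifStep-no (# 19) refl (unmarked-running (suc j) 1+j<W) ⟫ gotoStep (# 20) refl
        ⟫ shiftLoop l r (suc j) D E 1+j+[1+r]≡W)
    where
      1+j+[1+r]≡W : suc j + suc r ≡ W
      1+j+[1+r]≡W = trans (sym (+-suc j (suc r))) e
      1+j<W : suc j < W
      1+j<W = subst (suc j <_) 1+j+[1+r]≡W (m<m+n (suc j) z<s)

  blockPos-last : blockPos (n + n * W) ≡ (n , n)
  blockPos-last = trans (cong blockPos (+-comm n (n * W))) (blockPos-at n n ≤-refl)

  lastMarked-stage : ∀ la l → AutoPred.pred lastMarked (stageReg la l ∷ []) ≡ (n ≡ᵇ l)
  lastMarked-stage la l = trans (cellPred-encode finite-Bool false (λ _ c → mark c) (λ b → b) (stageTape la l))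
                 (trans (foldl-last (λ c → mark c) (n + n * W) (stageCellAt la l) false)
                        (cong (λ em → (proj₂ em ≡ᵇ l)) blockPos-last))

  lastHasStart-final : 1 ≤ n → AutoPred.pred lastHasStart (stageReg (suc n) n ∷ []) ≡ inL G w
  lastHasStart-final n1 =
      trans (cellPred-encode finite-Bool false (λ _ c → lookup (gen c) start) (λ b → b) (stageTape (suc n) n))
              (trans (foldl-last (λ c → lookup (gen c) start) (n + n * W) (stageCellAt (suc n) n) false)
              (trans (cong (λ em → lookup (tabulate (genSpec (suc n) (proj₁ em) (proj₂ em))) start) blockPos-last)
              (trans (lookup∘tabulate (genSpec (suc n) n n) start) fin)))
    where
      open BNFGrammar G using (start)
      inL-eq : ∀ v → 1 ≤ length v → memN G (length v) v start ≡ inL G v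
      inL-eq (a ∷ v) _ = refl
      fin : genSpec (suc n) n n start ≡ inL G w
      fin rewrite ≤⇒≤ᵇ′ 1 n n1 | ≤ᵇ′-refl n | n∸n≡0 n =
        trans (cong (λ z → derives z start) (take-all n w ≤-refl)) (inL-eq w n1)

  stageRegs : List (Fin g) → Registers
  stageRegs x = x ∷ baseReg W ∷ counterReg W ∷ counterReg 0 ∷ []

  computeColumn-fun : ∀ l → 1 ≤ l → l ≤ n → AutoFun.fn (cellwise computeColumn) (stageReg l l ∷ []) ≡ stageReg (suc l) l
  computeColumn-fun (suc l') _ l≤n =
    trans (cellwise-encode computeColumn (stageTape (suc l') (suc l'))) (cong encodeAll (NewColumn.computeColumn-tape (suc l') l≤n l' refl))

  stage : ∀ l → 1 ≤ l → l < n →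
      Reach (10 + 4 * n) (just (# 14)) (stageRegs (stageReg l l)) (just (# 14)) (stageRegs (stageReg (suc l) (suc l)))
  stage l 1≤l l<n = Reach-cast (cong (3 +_) (+-comm (3 + 4 * n) 4))
    (applyStep (# 14) refl (computeColumn-fun l 1≤l (<⇒≤ l<n))
      ⟫ ifStep-no (# 15) refl (trans (lastMarked-stage (suc l) l) (>⇒≡ᵇ-false n l l<n))
      ⟫ copyStep (# 16) refl ⟫ shiftLoop l n 0 (baseReg W) (counterReg 0) refl
      ⟫ applyStep (# 21) refl (shiftLeftParts-fun l W)
      ⟫ applyStep (# 22) refl (cellwise-encode carry (LeftShift.shiftedTape l (suc W)))
      ⟫ applyStep (# 23) refl (trans (cellwise-encode advanceMark (CellRun.runCells carry zeros (LeftShift.shiftedTape l (suc W)))) (cong encodeAll (LeftShift.stage-tape l 1≤l l<n)))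
      ⟫ gotoStep (# 24) refl)

  stages : 1 ≤ n → ∀ r l → l + r ≡ n → 1 ≤ l →
           Reach (r * (10 + 4 * n) + 2) (just (# 14)) (stageRegs (stageReg l l)) (just (# 25)) (stageRegs (stageReg (suc n) n))
  stages 1≤n zero l e 1≤l =
    subst (λ L → Reach 2 (just (# 14)) (stageRegs (stageReg L L)) (just (# 25)) (stageRegs (stageReg (suc n) n))) (sym l≡n)
      (applyStep (# 14) refl (computeColumn-fun n 1≤n ≤-refl)
        ⟫ ifStep-yes (# 15) refl (trans (lastMarked-stage (suc n) n) (≡ᵇ-refl n)))
    where
      l≡n : l ≡ n
      l≡n = trans (sym (+-identityʳ l)) e
  stages 1≤n (suc r) l e 1≤l = Reach-cast (sym (+-assoc (10 + 4 * n) (r * (10 + 4 * n)) 2))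
    (stage l 1≤l l<n ⟫ stages 1≤n r (suc l) (trans (sym (+-suc l r)) e) (s≤s z≤n))
    where
      l<n : l < n
      l<n = subst (l <_) e (m<m+n l z<s)

  final : 1 ≤ n → ∀ k → run decider w (2 + k) (just (# 25)) (stageRegs (stageReg (suc n) n)) ≡ just (inL G w)
  final 1≤n k = trans (cong verdict (lastHasStart-final 1≤n)) (verdict-is (inL G w))
    where
      verdict : Bool → Maybe Bool
      verdict b = if b then run decider w (1 + k) (just (# 27)) (stageRegs (stageReg (suc n) n))
                       else run decider w (1 + k) (just (# 26)) (stageRegs (stageReg (suc n) n))
      verdict-is : ∀ b → verdict b ≡ just b
      verdict-is true  = refl
      verdict-is false = refl

-- Correctness and running time

module Decider {s : ℕ} (G : BNFGrammar s) where
  open Program G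

  decider-ε : runFrom decider [] 3 ≡ just (inL G [])
  decider-ε with BNFGrammar.epsRule G
  ... | true  = refl
  ... | false = refl

  foldl-const-false : ∀ (x : List Cell) → foldl (λ _ _ → false) false x ≡ false
  foldl-const-false []      = refl
  foldl-const-false (c ∷ x) = foldl-const-false x

  module NonEmptyInput (a : Fin s) (w′ : List (Fin s)) where
    w : List (Fin s)
    w = a ∷ w′
    open Counter G
    open Layout G w
    open Factors G w
    open Stages G w
    open Rounds G w
    open StageRuns G w

    1≤n : 1 ≤ n
    1≤n = s≤s z≤n

    setup : Reach 4 (just (# 0)) (V.replicate 4 []) (just (# 4)) ([] ∷ baseReg 0 ∷ [] ∷ counterReg 0 ∷ [])
    setup = readInput
      ⟫ ifStep-no (# 1) refl (trans (cellPred-rawLetter finite-Bool true (λ _ _ → false) (λ b → b) w) (foldl-const-false (map letterCell w′)))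
      ⟫ applyStep (# 2) refl (trans (cellwise-rawLetter layBase w) (cong encodeAll layBase-input))
      ⟫ applyStep (# 3) refl (trans (cellwise-encode makeCounter (applyUpTo (baseCell 0) W)) (cong encodeAll makeCounter-base))
      where
        readInput : Reach 1 (just (# 0)) (V.replicate 4 []) (just (# 1)) ([] ∷ map rawLetter w ∷ [] ∷ [] ∷ [])
        readInput = mkR λ _ → refl

    initialisation : Reach 1 (just (# 13)) (encodeAll (roundTape W) ∷ baseReg W ∷ counterReg W ∷ counterReg 0 ∷ [])
                              (just (# 14)) (stageRegs (stageReg 1 1))
    initialisation =
        applyStep (# 13) refl (trans (cellwise-encode initialise (roundTape W)) (cong encodeAll initialise-tape))

    stepCount : ℕ
    stepCount = (4 + ((n * (8 + 4 * n) + (7 + 4 * n)) + (1 + (length w′ * (10 + 4 * n) + 2)))) + 2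

    decider-correct : runFrom decider w stepCount ≡ just (inL G w)
    decider-correct = trans (go wholeRun 2) (final 1≤n 0)
      where
        wholeRun : Reach (4 + ((n * (8 + 4 * n) + (7 + 4 * n)) + (1 + (length w′ * (10 + 4 * n) + 2))))
                         (just (# 0)) (V.replicate 4 []) (just (# 25)) (stageRegs (stageReg (suc n) n))
        wholeRun = setup ⟫ rounds 1≤n n 0 [] refl ⟫ initialisation ⟫ stages 1≤n (length w′) 1 refl (s≤s z≤n)

    stepCount-quadratic : stepCount ≤ 40 * n ^ 2
    stepCount-quadratic = subst (stepCount ≤_) (total-cost (length w′)) (m≤m+n stepCount _)

mainTheorem4 : {s : ℕ} (G : BNFGrammar s) → DAL (λ n → n ^ 2) (inL G)
mainTheorem4 {s} G = decider , 40 , 1 , decides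
  where
    open Program G using (decider)
    open Decider G
    decides : (w : List (Fin s)) → Σ ℕ λ steps →
              (runFrom decider w steps ≡ just (inL G w)) × (1 ≤ length w → steps ≤ 40 * length w ^ 2)
    decides []       = 3 , decider-ε , λ ()
    decides (a ∷ w′) = stepCount , decider-correct , λ _ → stepCount-quadratic
      where open NonEmptyInput a w′
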